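{- Let $N$ be a positive integer which is not expressible as the sum of two nonnegative integer squares. Then $\overline{C}_{3,1}(N) \equiv 0 \pmod{3}$.
   Context: An overpartition of $n$ is a partition of $n$ in which the first occurrence of each distinct part may optionally be overlined. For integers $k\ge 3$ and $1\le i\le \lfloor k/2\rfloor$, $\overline{C}_{k,i}(n)$ denotes the number of overpartitions of $n$ in which no part is divisible by $k$ and only parts congruent to $\pm i \pmod{k}$ may be overlined. Equivalently, $\sum_{n\ge0}\overline{C}_{k,i}(n)q^n = \frac{(q^k;q^k)_\infty(-q^i;q^k)_\infty(-q^{k-i};q^k)_\infty}{(q;q)_\infty}$, where $(A;q)_\infty=\prod_{j\ge0}(1-Aq^j)$. In particular $\sum_{n\ge0}\overline{C}_{3,1}(n)q^n=\frac{(q^3;q^3)_\infty(-q;q^3)_\infty(-q^2;q^3)_\infty}{(q;q)_\infty}$. -}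

module Defs where

open import Data.Nat using (ℕ; zero; suc; _+_; _*_; _∸_; _≤ᵇ_; NonZero)
open import Data.Nat.DivMod using (_%_)
open import Data.Nat.Properties using (_≟_)
open import Data.Bool using (Bool; true; false; if_then_else_; _∨_)
open import Data.List using (List; map; upTo)
open import Data.Nat.ListAction using (sum)
open import Relation.Nullary using (does)

-- Overpartitions counted by C̄_{k,i}(n):
--   overpartitions of n (a partition of n where the first occurrence of
--   each distinct part may optionally be overlined) such that
--   * no part is divisible by k, and
--   * only parts s with s ≡ i or s ≡ -i (mod k) may be overlined.
--
-- An overpartition is determined by choosing, for every part size s ≥ 1,
-- a multiplicity j ≥ 0 and, when j ≥ 1, whether the first occurrence of s
-- is overlined.  We count these choices directly.

allowed : (k : ℕ) → .{{NonZero k}} → ℕ → Bool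
allowed k s = if does (s % k ≟ 0) then false else true

overlinable : (k i : ℕ) → .{{NonZero k}} → ℕ → Bool
overlinable k i s = does (s % k ≟ i % k) ∨ does (s % k ≟ (k ∸ i) % k)

marks : Bool → ℕ
marks true  = 2
marks false = 1

-- cnt k i n m = number of such overpartitions of n all of whose parts are ≤ m
cnt : (k i : ℕ) → .{{NonZero k}} → ℕ → ℕ → ℕ
cnt k i zero    zero    = 1
cnt k i (suc n) zero    = 0
cnt k i n       (suc m) =
  if allowed k (suc m)
  then cnt k i n m
       + marks (overlinable k i (suc m))
         * sum (map (λ j → if (suc j * suc m) ≤ᵇ n
                           then cnt k i (n ∸ suc j * suc m) m
                           else 0)
                    (upTo n))
  else cnt k i n m
-- (the list upTo n = [0,…,n-1] ranges over multiplicities suc j = 1,…,n of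
--  the part size suc m)

Cbar : (k i : ℕ) → .{{NonZero k}} → ℕ → ℕ
Cbar k i n = cnt k i n n

module Submission where

-- Work in ℤ[[q]] (sequences ℕ → ℤ under convolution).  The generating
-- function of C̄_{3,1} is GF = ∏_{3 ∤ s} P(s) with P(s) = (1 + qˢ)/(1 - qˢ).
-- With A = ∏_s P(s) we have GF · ∏_s P(3s) = A, and the Frobenius congruence
-- P(s)³ ≡ P(3s) (mod 3) turns this into GF ≡ A⁻² = B² with
-- B = ∏_s (1 - qˢ)/(1 + qˢ).  Gauss's identity B = Σ_{n ∈ ℤ} (-1)ⁿ q^{n²},
-- obtained as a limit of a finite Jacobi triple product written with
-- Gaussian binomials in q², shows that B² is supported on sums of two
-- squares, so the coefficient of q^N in GF is ≡ 0 (mod 3).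
-- Infinite products are truncated throughout: f ≡[ E ] g says that the
-- coefficients below E agree modulo d (here d = 3, or any d for Gauss).

open import Defs
open import Data.Nat using (ℕ; _+_; _*_; _<_)
import Data.Integer.Base
open import Data.Nat.Divisibility using (_∣_)
open import Data.Product using (∃-syntax)
open import Relation.Nullary using (¬_)
open import Relation.Binary.PropositionalEquality using (_≡_)

module PowerSeries where

  open import Data.Nat using (zero; suc)
  import Data.Integer as ℤ
  open ℤ using (ℤ; +_)
  import Data.Integer.Properties as ℤP
  open import Data.Integer.Tactic.RingSolver using (solve-∀)
  open import Relation.Binary.PropositionalEquality
  open import Function using (_∘_)
  open import Algebra.Bundles using (CommutativeRing)
  open import Data.Product using (_,_)
  import Algebra.Solver.CommutativeMonoid as CommutativeMonoidSolver
  import Relation.Binary.Reasoning.Setoid as SetoidReasoning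

  Series : Set
  Series = ℕ → ℤ

  infixl 6 _⊕_
  infixl 7 _⊛_

  _⊕_ : Series → Series → Series
  (f ⊕ g) n = f n ℤ.+ g n

  ⊖_ : Series → Series
  (⊖ f) n = ℤ.- (f n)

  𝟘 𝟙 : Series
  𝟘 n = + 0
  𝟙 zero = + 1
  𝟙 (suc n) = + 0

  tail : Series → Series
  tail f = f ∘ suc

  _⊛_ : Series → Series → Series
  (f ⊛ g) zero = f 0 ℤ.* g 0
  (f ⊛ g) (suc n) = f 0 ℤ.* g (suc n) ℤ.+ (tail f ⊛ g) n

  shift : Series → Series
  shift f zero = + 0
  shift f (suc n) = f n

  scale : ℤ → Series → Series
  scale c f n = c ℤ.* f n

  -- The one-sided congruences name the fixed operand, which
  -- unification cannot recover from pointwise goals.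
  ⊕-cong : ∀ {f f′ g g′} → f ≗ f′ → g ≗ g′ → f ⊕ g ≗ f′ ⊕ g′
  ⊕-cong p q n = cong₂ ℤ._+_ (p n) (q n)

  ⊕-congˡ : ∀ {f f′} g → f ≗ f′ → f ⊕ g ≗ f′ ⊕ g
  ⊕-congˡ g p n = cong (λ z → z ℤ.+ g n) (p n)

  ⊕-congʳ : ∀ f {g g′} → g ≗ g′ → f ⊕ g ≗ f ⊕ g′
  ⊕-congʳ f q n = cong (ℤ._+_ (f n)) (q n)

  ⊛-cong : ∀ {f f′ g g′} → f ≗ f′ → g ≗ g′ → f ⊛ g ≗ f′ ⊛ g′
  ⊛-cong p q zero = cong₂ ℤ._*_ (p 0) (q 0)
  ⊛-cong p q (suc n) = cong₂ ℤ._+_ (cong₂ ℤ._*_ (p 0) (q (suc n))) (⊛-cong (p ∘ suc) q n)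

  ⊛-congˡ : ∀ {f f′} g → f ≗ f′ → f ⊛ g ≗ f′ ⊛ g
  ⊛-congˡ g p = ⊛-cong {g = g} {g′ = g} p (λ _ → refl)

  ⊛-congʳ : ∀ f {g g′} → g ≗ g′ → f ⊛ g ≗ f ⊛ g′
  ⊛-congʳ f q = ⊛-cong {f = f} {f′ = f} (λ _ → refl) q

  ⊛-zeroˡ : ∀ g → 𝟘 ⊛ g ≗ 𝟘
  ⊛-zeroˡ g zero = refl
  ⊛-zeroˡ g (suc n) = cong (ℤ._+_ (+ 0)) (⊛-zeroˡ g n)

  ⊛-zeroʳ : ∀ f → f ⊛ 𝟘 ≗ 𝟘
  ⊛-zeroʳ f zero = ℤP.*-zeroʳ (f 0)
  ⊛-zeroʳ f (suc n) = cong₂ ℤ._+_ (ℤP.*-zeroʳ (f 0)) (⊛-zeroʳ (tail f) n)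

  ⊛-identityˡ : ∀ g → 𝟙 ⊛ g ≗ g
  ⊛-identityˡ g zero = ℤP.*-identityˡ (g 0)
  ⊛-identityˡ g (suc n) =
    trans (cong₂ ℤ._+_ (ℤP.*-identityˡ (g (suc n))) (⊛-zeroˡ g n)) (ℤP.+-identityʳ _)

  scale-⊛ : ∀ c f g → scale c f ⊛ g ≗ scale c (f ⊛ g)
  scale-⊛ c f g zero = ℤP.*-assoc c (f 0) (g 0)
  scale-⊛ c f g (suc n) =
    trans (cong₂ ℤ._+_ (ℤP.*-assoc c (f 0) (g (suc n))) (scale-⊛ c (tail f) g n))
          (sym (ℤP.*-distribˡ-+ c (f 0 ℤ.* g (suc n)) ((tail f ⊛ g) n)))

  ⊛-distribʳ : ∀ f g h → (f ⊕ g) ⊛ h ≗ f ⊛ h ⊕ g ⊛ h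
  ⊛-distribʳ f g h zero = ℤP.*-distribʳ-+ (h 0) (f 0) (g 0)
  ⊛-distribʳ f g h (suc n) rewrite ⊛-distribʳ (tail f) (tail g) h n =
    regroup (f 0) (g 0) (h (suc n)) ((tail f ⊛ h) n) ((tail g ⊛ h) n)
    where
    regroup : ∀ a b c x y → (a ℤ.+ b) ℤ.* c ℤ.+ (x ℤ.+ y) ≡ (a ℤ.* c ℤ.+ x) ℤ.+ (b ℤ.* c ℤ.+ y)
    regroup = solve-∀

  ⊛-distribˡ : ∀ f g h → f ⊛ (g ⊕ h) ≗ f ⊛ g ⊕ f ⊛ h
  ⊛-distribˡ f g h zero = ℤP.*-distribˡ-+ (f 0) (g 0) (h 0)
  ⊛-distribˡ f g h (suc n) rewrite ⊛-distribˡ (tail f) g h n =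
    regroup (f 0) (g (suc n)) (h (suc n)) ((tail f ⊛ g) n) ((tail f ⊛ h) n)
    where
    regroup : ∀ a b c x y → a ℤ.* (b ℤ.+ c) ℤ.+ (x ℤ.+ y) ≡ (a ℤ.* b ℤ.+ x) ℤ.+ (a ℤ.* c ℤ.+ y)
    regroup = solve-∀

  -- the product also satisfies the mirrored recursion on the right factor,
  -- which is what commutativity needs
  ⊛-suc-tailʳ : ∀ f g n → (f ⊛ g) (suc n) ≡ f (suc n) ℤ.* g 0 ℤ.+ (f ⊛ tail g) n
  ⊛-suc-tailʳ f g zero = ℤP.+-comm (f 0 ℤ.* g 1) (f 1 ℤ.* g 0)
  ⊛-suc-tailʳ f g (suc n) rewrite ⊛-suc-tailʳ (tail f) g n =
    swap (f 0) (g (suc (suc n))) (f (suc (suc n)) ℤ.* g 0) ((tail f ⊛ tail g) n)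
    where
    swap : ∀ a b c x → a ℤ.* b ℤ.+ (c ℤ.+ x) ≡ c ℤ.+ (a ℤ.* b ℤ.+ x)
    swap = solve-∀

  ⊛-comm : ∀ f g → f ⊛ g ≗ g ⊛ f
  ⊛-comm f g zero = ℤP.*-comm (f 0) (g 0)
  ⊛-comm f g (suc n) =
    trans (cong₂ ℤ._+_ (ℤP.*-comm (f 0) (g (suc n))) (⊛-comm (tail f) g n))
          (sym (⊛-suc-tailʳ g f n))

  ⊛-assoc : ∀ f g h → (f ⊛ g) ⊛ h ≗ f ⊛ (g ⊛ h)
  ⊛-assoc f g h zero = ℤP.*-assoc (f 0) (g 0) (h 0)
  ⊛-assoc f g h (suc n) =
    trans (cong (ℤ._+_ (f 0 ℤ.* g 0 ℤ.* h (suc n)))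
            (trans (⊛-distribʳ (scale (f 0) (tail g)) (tail f ⊛ g) h n)
                   (cong₂ ℤ._+_ (scale-⊛ (f 0) (tail g) h n) (⊛-assoc (tail f) g h n))))
          (regroup (f 0) (g 0) (h (suc n)) ((tail g ⊛ h) n) ((tail f ⊛ (g ⊛ h)) n))
    where
    regroup : ∀ a b c x y → a ℤ.* b ℤ.* c ℤ.+ (a ℤ.* x ℤ.+ y) ≡ a ℤ.* (b ℤ.* c ℤ.+ x) ℤ.+ y
    regroup = solve-∀

  ⊛-identityʳ : ∀ f → f ⊛ 𝟙 ≗ f
  ⊛-identityʳ f n = trans (⊛-comm f 𝟙 n) (⊛-identityˡ f n)

  seriesRing : CommutativeRing _ _
  seriesRing = record
    { Carrier = Series ; _≈_ = _≗_ ; _+_ = _⊕_ ; _*_ = _⊛_ ; -_ = ⊖_ ; 0# = 𝟘 ; 1# = 𝟙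
    ; isCommutativeRing = record
      { isRing = record
        { +-isAbelianGroup = record
          { isGroup = record
            { isMonoid = record
              { isSemigroup = record
                { isMagma = record
                  { isEquivalence = record { refl = λ _ → refl ; sym = λ p n → sym (p n)
                                           ; trans = λ p q n → trans (p n) (q n) }
                  ; ∙-cong = ⊕-cong }
                ; assoc = λ f g h n → ℤP.+-assoc (f n) (g n) (h n) }
              ; identity = (λ f n → ℤP.+-identityˡ (f n)) , (λ f n → ℤP.+-identityʳ (f n)) }
            ; inverse = (λ f n → ℤP.+-inverseˡ (f n)) , (λ f n → ℤP.+-inverseʳ (f n))
            ; ⁻¹-cong = λ p n → cong ℤ.-_ (p n) }
          ; comm = λ f g n → ℤP.+-comm (f n) (g n) }
        ; *-cong = ⊛-cong
        ; *-assoc = ⊛-assoc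
        ; *-identity = ⊛-identityˡ , ⊛-identityʳ
        ; distrib = ⊛-distribˡ , (λ h f g → ⊛-distribʳ f g h) }
      ; *-comm = ⊛-comm } }

  ⊛-negˡ : ∀ f g → (⊖ f) ⊛ g ≗ ⊖ (f ⊛ g)
  ⊛-negˡ f g zero = sym (ℤP.neg-distribˡ-* (f 0) (g 0))
  ⊛-negˡ f g (suc n) =
    trans (cong₂ ℤ._+_ (sym (ℤP.neg-distribˡ-* (f 0) (g (suc n)))) (⊛-negˡ (tail f) g n))
          (sym (ℤP.neg-distrib-+ (f 0 ℤ.* g (suc n)) ((tail f ⊛ g) n)))

  ⊛-negʳ : ∀ f g → f ⊛ (⊖ g) ≗ ⊖ (f ⊛ g)
  ⊛-negʳ f g n = trans (⊛-comm f (⊖ g) n) (trans (⊛-negˡ g f n) (cong ℤ.-_ (⊛-comm g f n)))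

  ⊛-scaleʳ : ∀ f c g → f ⊛ scale c g ≗ scale c (f ⊛ g)
  ⊛-scaleʳ f c g n = trans (⊛-comm f (scale c g) n) (trans (scale-⊛ c g f n) (cong (c ℤ.*_) (⊛-comm g f n)))

  one+-⊛ : ∀ x y → (𝟙 ⊕ x) ⊛ y ≗ y ⊕ x ⊛ y
  one+-⊛ x y n = trans (⊛-distribʳ 𝟙 x y n) (cong (λ z → z ℤ.+ (x ⊛ y) n) (⊛-identityˡ y n))

  ⊛-one+ : ∀ x y → y ⊛ (𝟙 ⊕ x) ≗ y ⊕ y ⊛ x
  ⊛-one+ x y n = trans (⊛-distribˡ y 𝟙 x n) (cong (λ z → z ℤ.+ (y ⊛ x) n) (⊛-identityʳ y n))

  ⊛-vanishʳ : ∀ f {g} → g ≗ 𝟘 → f ⊛ g ≗ 𝟘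
  ⊛-vanishʳ f p n = trans (⊛-congʳ f p n) (⊛-zeroʳ f n)

  ⊛-vanishˡ : ∀ {f} g → f ≗ 𝟘 → f ⊛ g ≗ 𝟘
  ⊛-vanishˡ g p n = trans (⊛-congˡ g p n) (⊛-zeroˡ g n)

  module ≗-Reasoning = SetoidReasoning (CommutativeRing.setoid seriesRing)

  ⊕-interchange : ∀ a b c d → (a ⊕ b) ⊕ (c ⊕ d) ≗ (a ⊕ c) ⊕ (b ⊕ d)
  ⊕-interchange a b c d n = interchange (a n) (b n) (c n) (d n)
    where
    interchange : ∀ a b c d → (a ℤ.+ b) ℤ.+ (c ℤ.+ d) ≡ (a ℤ.+ c) ℤ.+ (b ℤ.+ d)
    interchange = solve-∀

  module ⊛-Solver = CommutativeMonoidSolver (CommutativeRing.*-commutativeMonoid seriesRing)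
    renaming (_⊕_ to _·_)

module TruncatedCongruence (d : Data.Integer.Base.ℤ) where

  open import Data.Nat using (zero; suc; z≤n; s≤s; _≤_)
  import Data.Nat.Properties as ℕP
  import Data.Integer as ℤ
  open ℤ using (+_)
  import Data.Integer.Properties as ℤP
  open import Data.Integer.Divisibility.Signed as ℤ∣
    using (divides; ∣m∣n⇒∣m+n; ∣m⇒∣-m; ∣n⇒∣m*n)
  open import Data.Integer.Tactic.RingSolver using (solve-∀)
  open import Relation.Binary.PropositionalEquality
  open import Relation.Binary.Bundles using (Setoid)
  import Relation.Binary.Reasoning.Setoid as SetoidReasoning
  open PowerSeries

  infix 4 _≡[_]_
  record _≡[_]_ (f : Series) (E : ℕ) (g : Series) : Set where
    constructor mk≡
    field coefficients : ∀ n → n < E → d ℤ∣.∣ f n ℤ.- g n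
  open _≡[_]_ public

  private
    d∣0 : d ℤ∣.∣ + 0
    d∣0 = divides (+ 0) (sym (ℤP.*-zeroˡ d))

    d∣-resp : ∀ {a b} → a ≡ b → d ℤ∣.∣ a → d ℤ∣.∣ b
    d∣-resp = subst (d ℤ∣.∣_)

  ≡[]-pointwise : ∀ {E f g} → (∀ n → n < E → f n ≡ g n) → f ≡[ E ] g
  ≡[]-pointwise {f = f} p =
    mk≡ λ n l → d∣-resp (trans (sym (ℤP.+-inverseʳ (f n))) (cong (λ z → f n ℤ.- z) (p n l))) d∣0

  ≗⇒≡[] : ∀ {E f g} → f ≗ g → f ≡[ E ] g
  ≗⇒≡[] p = ≡[]-pointwise (λ n _ → p n)

  ≡[]-refl : ∀ {E} f → f ≡[ E ] f
  ≡[]-refl f = ≗⇒≡[] (λ _ → refl)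

  ≡[]-sym : ∀ {E f g} → f ≡[ E ] g → g ≡[ E ] f
  ≡[]-sym {f = f} {g} (mk≡ p) = mk≡ λ n l → d∣-resp (negate (f n) (g n)) (∣m⇒∣-m (p n l))
    where
    negate : ∀ a b → ℤ.- (a ℤ.- b) ≡ b ℤ.- a
    negate = solve-∀

  ≡[]-trans : ∀ {E f g h} → f ≡[ E ] g → g ≡[ E ] h → f ≡[ E ] h
  ≡[]-trans {f = f} {g} {h} (mk≡ p) (mk≡ q) = mk≡ λ n l → d∣-resp (telescope (f n) (g n) (h n)) (∣m∣n⇒∣m+n (p n l) (q n l))
    where
    telescope : ∀ a b c → (a ℤ.- b) ℤ.+ (b ℤ.- c) ≡ a ℤ.- c
    telescope = solve-∀

  ≡[]-setoid : ℕ → Setoid _ _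
  ≡[]-setoid E = record
    { Carrier = Series ; _≈_ = λ f g → f ≡[ E ] g
    ; isEquivalence = record { refl = ≡[]-refl _ ; sym = ≡[]-sym ; trans = ≡[]-trans } }

  module ≡[]-Reasoning (E : ℕ) where
    open SetoidReasoning (≡[]-setoid E) public
    step-≗-⟩ : ∀ f {g h} → g IsRelatedTo h → f ≗ g → f IsRelatedTo h
    step-≗-⟩ f g∼h f≗g = step-≈-⟩ f g∼h (≗⇒≡[] f≗g)
    step-≗-⟨ : ∀ f {g h} → g IsRelatedTo h → g ≗ f → f IsRelatedTo h
    step-≗-⟨ f g∼h g≗f = step-≈-⟩ f g∼h (≗⇒≡[] (λ n → sym (g≗f n)))
    syntax step-≗-⟩ f g∼h f≗g = f ≗⟨ f≗g ⟩ g∼h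
    syntax step-≗-⟨ f g∼h g≗f = f ≗⟨ g≗f ⟨ g∼h
    infixr 2 step-≗-⟩ step-≗-⟨

  ≡[]-weaken : ∀ {E E′ f g} → E′ ≤ E → f ≡[ E ] g → f ≡[ E′ ] g
  ≡[]-weaken le (mk≡ p) = mk≡ λ n l → p n (ℕP.<-≤-trans l le)

  ≡[]-⊕ : ∀ {E f f′ g g′} → f ≡[ E ] f′ → g ≡[ E ] g′ → f ⊕ g ≡[ E ] f′ ⊕ g′
  ≡[]-⊕ {f = f} {f′} {g} {g′} (mk≡ p) (mk≡ q) =
    mk≡ λ n l → d∣-resp (regroup (f n) (f′ n) (g n) (g′ n)) (∣m∣n⇒∣m+n (p n l) (q n l))
    where
    regroup : ∀ a b c e → (a ℤ.- b) ℤ.+ (c ℤ.- e) ≡ (a ℤ.+ c) ℤ.- (b ℤ.+ e)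
    regroup = solve-∀

  ≡[]-⊖ : ∀ {E f g} → f ≡[ E ] g → ⊖ f ≡[ E ] ⊖ g
  ≡[]-⊖ {f = f} {g} (mk≡ p) = mk≡ λ n l → d∣-resp (negate (f n) (g n)) (∣m⇒∣-m (p n l))
    where
    negate : ∀ a b → ℤ.- (a ℤ.- b) ≡ ℤ.- a ℤ.- ℤ.- b
    negate = solve-∀

  ≡[]-scale : ∀ {E f g} c → f ≡[ E ] g → scale c f ≡[ E ] scale c g
  ≡[]-scale {f = f} {g} c (mk≡ p) = mk≡ λ n l → d∣-resp (distrib c (f n) (g n)) (∣n⇒∣m*n c (p n l))
    where
    distrib : ∀ s a b → s ℤ.* (a ℤ.- b) ≡ s ℤ.* a ℤ.- s ℤ.* b
    distrib = solve-∀

  ≡[]-shift : ∀ {E f g} → f ≡[ E ] g → shift f ≡[ suc E ] shift g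
  ≡[]-shift (mk≡ p) = mk≡ λ where
    zero _ → d∣-resp (sym (ℤP.+-inverseʳ (+ 0))) d∣0
    (suc n) (s≤s l) → p n l

  ∣-⊛ : ∀ n (e h : Series) → (∀ j → j ≤ n → d ℤ∣.∣ e j) → d ℤ∣.∣ (e ⊛ h) n
  ∣-⊛ zero e h p = d∣-resp (ℤP.*-comm (h 0) (e 0)) (∣n⇒∣m*n (h 0) (p 0 z≤n))
  ∣-⊛ (suc n) e h p =
    ∣m∣n⇒∣m+n (d∣-resp (ℤP.*-comm (h (suc n)) (e 0)) (∣n⇒∣m*n (h (suc n)) (p 0 z≤n)))
              (∣-⊛ n (tail e) h (λ j le → p (suc j) (s≤s le)))

  ≡[]-⊛ˡ : ∀ {E f f′} g → f ≡[ E ] f′ → f ⊛ g ≡[ E ] f′ ⊛ g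
  ≡[]-⊛ˡ {f = f} {f′} g (mk≡ p) = mk≡ λ n l →
    d∣-resp (difference n) (∣-⊛ n (f ⊕ ⊖ f′) g (λ j le → p j (ℕP.≤-<-trans le l)))
    where
    difference : ∀ n → ((f ⊕ ⊖ f′) ⊛ g) n ≡ (f ⊛ g) n ℤ.- (f′ ⊛ g) n
    difference n = trans (⊛-distribʳ f (⊖ f′) g n) (cong (ℤ._+_ ((f ⊛ g) n)) (⊛-negˡ f′ g n))

  ≡[]-⊛ʳ : ∀ {E g g′} f → g ≡[ E ] g′ → f ⊛ g ≡[ E ] f ⊛ g′
  ≡[]-⊛ʳ {g = g} {g′} f p =
    ≡[]-trans (≗⇒≡[] (⊛-comm f g)) (≡[]-trans (≡[]-⊛ˡ f p) (≗⇒≡[] (⊛-comm g′ f)))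

  ≡[]-⊛ : ∀ {E f f′ g g′} → f ≡[ E ] f′ → g ≡[ E ] g′ → f ⊛ g ≡[ E ] f′ ⊛ g′
  ≡[]-⊛ {f′ = f′} {g} p q = ≡[]-trans (≡[]-⊛ˡ g p) (≡[]-⊛ʳ f′ q)

  ≡[]-multiple : ∀ {E} f g → f ⊕ scale d g ≡[ E ] f
  ≡[]-multiple f g = mk≡ λ n _ → divides (g n) (cancel (f n) (g n) d)
    where
    cancel : ∀ a b e → (a ℤ.+ e ℤ.* b) ℤ.- a ≡ b ℤ.* e
    cancel = solve-∀

module Monomials where

  open import Data.Nat using (zero; suc; z≤n; s≤s; _≤_)
  import Data.Nat.Properties as ℕP
  open import Data.Nat.Divisibility using (_∣?_; n∣n; _∣0; ∣m∣n⇒∣m+n; ∣m+n∣m⇒∣n; ∣⇒≤)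
  import Data.Integer as ℤ
  open ℤ using (ℤ; +_)
  import Data.Integer.Properties as ℤP
  open import Data.Integer.Tactic.RingSolver using (solve-∀)
  open import Relation.Binary.PropositionalEquality
  open import Relation.Nullary using (Dec; yes; no)
  open import Data.Empty using (⊥-elim)
  open PowerSeries

  q^_ : ℕ → Series
  (q^ zero) = 𝟙
  (q^ suc a) zero = + 0
  (q^ suc a) (suc n) = (q^ a) n

  q^suc-⊛ : ∀ a f → q^ suc a ⊛ f ≗ shift (q^ a ⊛ f)
  q^suc-⊛ a f zero = ℤP.*-zeroˡ (f 0)
  q^suc-⊛ a f (suc n) =
    trans (cong (λ z → z ℤ.+ (q^ a ⊛ f) n) (ℤP.*-zeroˡ (f (suc n)))) (ℤP.+-identityˡ _)

  q^-+ : ∀ a b → q^ a ⊛ q^ b ≗ q^ (a + b)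
  q^-+ zero b = ⊛-identityˡ (q^ b)
  q^-+ (suc a) b n = trans (q^suc-⊛ a (q^ b) n) (shifted n)
    where
    shifted : ∀ n → shift (q^ a ⊛ q^ b) n ≡ (q^ suc (a + b)) n
    shifted zero = refl
    shifted (suc n) = q^-+ a b n

  q^-⊛-q^ : ∀ a b f → q^ a ⊛ (q^ b ⊛ f) ≗ q^ (a + b) ⊛ f
  q^-⊛-q^ a b f n = trans (sym (⊛-assoc (q^ a) (q^ b) f n)) (⊛-congˡ f (q^-+ a b) n)

  q^-cong : ∀ {a b} → a ≡ b → q^ a ≗ q^ b
  q^-cong refl n = refl

  q^-⊛-below : ∀ a f n → n < a → (q^ a ⊛ f) n ≡ + 0
  q^-⊛-below (suc a) f zero l = ℤP.*-zeroˡ (f 0)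
  q^-⊛-below (suc a) f (suc n) (s≤s l) = trans (q^suc-⊛ a f (suc n)) (q^-⊛-below a f n l)

  q^-⊛-above : ∀ a f n → (q^ a ⊛ f) (a + n) ≡ f n
  q^-⊛-above zero f n = ⊛-identityˡ f n
  q^-⊛-above (suc a) f n = trans (q^suc-⊛ a f (suc (a + n))) (q^-⊛-above a f n)

  data Threshold (a : ℕ) : ℕ → Set where
    below : ∀ {n} → n < a → Threshold a n
    above : ∀ m → Threshold a (a + m)

  threshold : ∀ a n → Threshold a n
  threshold zero n = above n
  threshold (suc a) zero = below (s≤s z≤n)
  threshold (suc a) (suc n) with threshold a n
  ... | below l = below (s≤s l)
  ... | above m = above m

  module _ {d : ℤ} where
    open TruncatedCongruence d

    q^-≡[] : ∀ {E f g} a → f ≡[ E ] g → q^ a ⊛ f ≡[ a + E ] q^ a ⊛ g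
    q^-≡[] zero p = ≡[]-trans (≗⇒≡[] (⊛-identityˡ _)) (≡[]-trans p (≗⇒≡[] (λ n → sym (⊛-identityˡ _ n))))
    q^-≡[] {E} {f} {g} (suc a) p =
      ≡[]-trans (≗⇒≡[] (q^suc-⊛ a f))
        (≡[]-trans (≡[]-shift (q^-≡[] a p)) (≗⇒≡[] (λ n → sym (q^suc-⊛ a g n))))

    q^-≡[]-𝟘 : ∀ {E} a f → E ≤ a → q^ a ⊛ f ≡[ E ] 𝟘
    q^-≡[]-𝟘 a f le = ≡[]-pointwise λ n l → q^-⊛-below a f n (ℕP.<-≤-trans l le)

  indicator : {P : Set} → Dec P → ℤ
  indicator (yes _) = + 1
  indicator (no _) = + 0

  -- 1/(1 - qˢ) = Σ_{s ∣ n} qⁿ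
  geometric : ℕ → Series
  geometric s n = indicator (s ∣? n)

  geometric-unfold : ∀ s → geometric (suc s) ≗ 𝟙 ⊕ q^ suc s ⊛ geometric (suc s)
  geometric-unfold s n with threshold (suc s) n
  ... | below l = trans (initial n l) (sym (trans (cong (ℤ._+_ (𝟙 n)) (q^-⊛-below (suc s) _ n l)) (ℤP.+-identityʳ _)))
    where
    initial : ∀ n → n < suc s → geometric (suc s) n ≡ 𝟙 n
    initial zero _ with suc s ∣? 0
    ... | yes _ = refl
    ... | no ∤0 = ⊥-elim (∤0 (suc s ∣0))
    initial (suc n) l with suc s ∣? suc n
    ... | yes s∣n = ⊥-elim (ℕP.<⇒≱ l (∣⇒≤ s∣n))
    ... | no _ = refl
  ... | above m = trans periodic (sym (trans (cong (ℤ._+_ (+ 0)) (q^-⊛-above (suc s) _ m)) (ℤP.+-identityˡ _)))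
    where
    periodic : geometric (suc s) (suc s + m) ≡ geometric (suc s) m
    periodic with suc s ∣? (suc s + m) | suc s ∣? m
    ... | yes _ | yes _ = refl
    ... | no _  | no _  = refl
    ... | yes p | no ¬p = ⊥-elim (¬p (∣m+n∣m⇒∣n p n∣n))
    ... | no ¬p | yes p = ⊥-elim (¬p (∣m∣n⇒∣m+n n∣n p))

  geometric-inverse : ∀ s → (𝟙 ⊕ ⊖ q^ suc s) ⊛ geometric (suc s) ≗ 𝟙
  geometric-inverse s n =
    trans (⊛-distribʳ 𝟙 (⊖ q^ suc s) (geometric (suc s)) n)
      (trans (cong₂ ℤ._+_ (trans (⊛-identityˡ _ n) (geometric-unfold s n)) (⊛-negˡ (q^ suc s) (geometric (suc s)) n))
             (cancel (𝟙 n) ((q^ suc s ⊛ geometric (suc s)) n)))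
    where
    cancel : ∀ a b → (a ℤ.+ b) ℤ.+ ℤ.- b ≡ a
    cancel = solve-∀

module Products where

  open import Data.Nat using (zero; suc; _≤_; _∸_)
  import Data.Nat.Properties as ℕP
  open import Relation.Binary.PropositionalEquality
  open PowerSeries
  open ⊛-Solver using (solve; _⊜_; _·_)

  ∏ : (ℕ → Series) → ℕ → Series
  ∏ f zero = 𝟙
  ∏ f (suc m) = ∏ f m ⊛ f m

  ∏-⊛ : ∀ f g m → ∏ f m ⊛ ∏ g m ≗ ∏ (λ i → f i ⊛ g i) m
  ∏-⊛ f g zero = ⊛-identityˡ 𝟙
  ∏-⊛ f g (suc m) n =
    trans (interchange (∏ f m) (f m) (∏ g m) (g m) n) (⊛-cong (∏-⊛ f g m) (λ _ → refl) n)
    where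
    interchange : ∀ (A a B b : Series) → (A ⊛ a) ⊛ (B ⊛ b) ≗ (A ⊛ B) ⊛ (a ⊛ b)
    interchange = solve 4 (λ A a B b → ((A · a) · (B · b)) ⊜ ((A · B) · (a · b))) (λ _ → refl)

  ∏-cong : ∀ {f g} m → (∀ i → i < m → f i ≗ g i) → ∏ f m ≗ ∏ g m
  ∏-cong zero p = λ _ → refl
  ∏-cong (suc m) p = ⊛-cong (∏-cong m (λ i l → p i (ℕP.m<n⇒m<1+n l))) (p m ℕP.≤-refl)

  ∏-𝟙 : ∀ m → ∏ (λ _ → 𝟙) m ≗ 𝟙
  ∏-𝟙 zero = λ _ → refl
  ∏-𝟙 (suc m) n = trans (⊛-identityʳ _ n) (∏-𝟙 m n)

  ∏-inverse : ∀ f g m → (∀ i → f i ⊛ g i ≗ 𝟙) → ∏ f m ⊛ ∏ g m ≗ 𝟙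
  ∏-inverse f g m p n = trans (∏-⊛ f g m n) (trans (∏-cong m (λ i _ → p i) n) (∏-𝟙 m n))

  module _ {d : Data.Integer.Base.ℤ} where
    open TruncatedCongruence d

    ∏-≡[] : ∀ {E f g} m → (∀ i → i < m → f i ≡[ E ] g i) → ∏ f m ≡[ E ] ∏ g m
    ∏-≡[] zero p = ≡[]-refl 𝟙
    ∏-≡[] (suc m) p = ≡[]-⊛ (∏-≡[] m (λ i l → p i (ℕP.m<n⇒m<1+n l))) (p m ℕP.≤-refl)

    ∏-extend : ∀ {E} f m M → m ≤ M → (∀ i → m ≤ i → f i ≡[ E ] 𝟙) → ∏ f M ≡[ E ] ∏ f m
    ∏-extend {E} f m M m≤M p = subst (λ z → ∏ f z ≡[ E ] ∏ f m) (ℕP.m∸n+n≡m m≤M) (go (M ∸ m))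
      where
      go : ∀ k → ∏ f (k + m) ≡[ E ] ∏ f m
      go zero = ≡[]-refl _
      go (suc k) = ≡[]-trans (≡[]-⊛ (go k) (p (k + m) (ℕP.m≤n+m m k))) (≗⇒≡[] (⊛-identityʳ _))

-- The factors of the infinite products: P(s) = (1 + qˢ)/(1 - qˢ), its
-- inverse P⁻¹(s) = (1 - qˢ)/(1 + qˢ), and 1/(1 + qˢ) = (1 - qˢ)/(1 - q²ˢ).
module Factors where

  open import Data.Nat using (suc; _≤_)
  import Data.Nat.Properties as ℕP
  import Data.Integer as ℤ
  open ℤ using (ℤ; +_)
  import Data.Integer.Properties as ℤP
  open import Data.Integer.Tactic.RingSolver using (solve-∀)
  open import Relation.Binary.PropositionalEquality
  open PowerSeries
  open ⊛-Solver using (solve; _⊜_; _·_)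
  open Monomials

  P : ℕ → Series
  P s = (𝟙 ⊕ q^ s) ⊛ geometric s

  invOnePlus : ℕ → Series
  invOnePlus s = (𝟙 ⊕ ⊖ q^ s) ⊛ geometric (s + s)

  P⁻¹ : ℕ → Series
  P⁻¹ s = (𝟙 ⊕ ⊖ q^ s) ⊛ invOnePlus s

  difference-of-squares : ∀ a → (𝟙 ⊕ q^ a) ⊛ (𝟙 ⊕ ⊖ q^ a) ≗ 𝟙 ⊕ ⊖ q^ (a + a)
  difference-of-squares a n = begin
      ((𝟙 ⊕ q^ a) ⊛ (𝟙 ⊕ ⊖ q^ a)) n
    ≡⟨ ⊛-one+ (⊖ q^ a) (𝟙 ⊕ q^ a) n ⟩
      (𝟙 ⊕ q^ a) n ℤ.+ ((𝟙 ⊕ q^ a) ⊛ ⊖ q^ a) n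
    ≡⟨ cong (ℤ._+_ ((𝟙 ⊕ q^ a) n)) (trans (⊛-negʳ (𝟙 ⊕ q^ a) (q^ a) n) (cong ℤ.-_ (one+-⊛ (q^ a) (q^ a) n))) ⟩
      (𝟙 n ℤ.+ (q^ a) n) ℤ.+ ℤ.- ((q^ a) n ℤ.+ (q^ a ⊛ q^ a) n)
    ≡⟨ cong (λ z → (𝟙 n ℤ.+ (q^ a) n) ℤ.+ ℤ.- ((q^ a) n ℤ.+ z)) (q^-+ a a n) ⟩
      (𝟙 n ℤ.+ (q^ a) n) ℤ.+ ℤ.- ((q^ a) n ℤ.+ (q^ (a + a)) n)
    ≡⟨ cancel (𝟙 n) ((q^ a) n) ((q^ (a + a)) n) ⟩
      𝟙 n ℤ.+ ℤ.- (q^ (a + a)) n ∎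
    where
    open ≡-Reasoning
    cancel : ∀ p x y → (p ℤ.+ x) ℤ.+ ℤ.- (x ℤ.+ y) ≡ p ℤ.+ ℤ.- y
    cancel = solve-∀

  -- (1 + qˢ) · 1/(1 + qˢ) = (1 - q²ˢ)/(1 - q²ˢ) = 1
  invOnePlus-inverse : ∀ s → (𝟙 ⊕ q^ suc s) ⊛ invOnePlus (suc s) ≗ 𝟙
  invOnePlus-inverse s n =
    trans (sym (⊛-assoc (𝟙 ⊕ q^ suc s) (𝟙 ⊕ ⊖ q^ suc s) (geometric (suc s + suc s)) n))
      (trans (⊛-cong (difference-of-squares (suc s)) (λ _ → refl) n) (geometric-inverse (s + suc s) n))

  P-inverse : ∀ s → P (suc s) ⊛ P⁻¹ (suc s) ≗ 𝟙
  P-inverse s n = begin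
      ((u⁺ ⊛ geometric (suc s)) ⊛ (u⁻ ⊛ invOnePlus (suc s))) n
    ≡⟨ regroup u⁺ (geometric (suc s)) u⁻ (invOnePlus (suc s)) n ⟩
      ((u⁻ ⊛ geometric (suc s)) ⊛ (u⁺ ⊛ invOnePlus (suc s))) n
    ≡⟨ ⊛-cong (geometric-inverse s) (invOnePlus-inverse s) n ⟩
      (𝟙 ⊛ 𝟙) n
    ≡⟨ ⊛-identityˡ 𝟙 n ⟩
      𝟙 n ∎
    where
    open ≡-Reasoning
    u⁺ = 𝟙 ⊕ q^ suc s
    u⁻ = 𝟙 ⊕ ⊖ q^ suc s
    regroup : ∀ (a g b h : Series) → (a ⊛ g) ⊛ (b ⊛ h) ≗ (b ⊛ g) ⊛ (a ⊛ h)
    regroup = solve 4 (λ a g b h → ((a · g) · (b · h)) ⊜ ((b · g) · (a · h))) (λ _ → refl)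

  -- P(s) = 1 + 2 qˢ/(1 - qˢ): one choice of multiplicity for each of the
  -- two markings of the part s
  P-unfold : ∀ s → P (suc s) ≗ 𝟙 ⊕ (q^ suc s ⊛ geometric (suc s) ⊕ q^ suc s ⊛ geometric (suc s))
  P-unfold s n =
    trans (one+-⊛ (q^ suc s) (geometric (suc s)) n)
      (trans (cong (λ z → z ℤ.+ (q^ suc s ⊛ geometric (suc s)) n) (geometric-unfold s n))
             (ℤP.+-assoc (𝟙 n) _ _))

  module _ {d : ℤ} where
    open TruncatedCongruence d

    one-minus-≡[] : ∀ {E} a → E ≤ a → 𝟙 ⊕ ⊖ q^ a ≡[ E ] 𝟙
    one-minus-≡[] a le =
      ≡[]-trans (≡[]-⊕ (≡[]-refl 𝟙) (≡[]-⊖ (≡[]-trans (≗⇒≡[] (λ n → sym (⊛-identityʳ (q^ a) n))) (q^-≡[]-𝟘 a 𝟙 le))))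
                (≗⇒≡[] (λ n → ℤP.+-identityʳ (𝟙 n)))

    P-≡[]-𝟙 : ∀ s → P (suc s) ≡[ suc s ] 𝟙
    P-≡[]-𝟙 s =
      ≡[]-trans (≗⇒≡[] (P-unfold s))
        (≡[]-trans (≡[]-⊕ (≡[]-refl 𝟙) (≡[]-⊕ vanishing vanishing))
                   (≗⇒≡[] (λ n → ℤP.+-identityʳ (𝟙 n))))
      where
      vanishing = q^-≡[]-𝟘 (suc s) (geometric (suc s)) ℕP.≤-refl

    invOnePlus-≡[]-𝟙 : ∀ s → invOnePlus (suc s) ≡[ suc s ] 𝟙
    invOnePlus-≡[]-𝟙 s =
      ≡[]-trans (≗⇒≡[] (λ n → trans (one+-⊛ (⊖ q^ suc s) G n)
                                  (cong₂ ℤ._+_ (geometric-unfold (s + suc s) n) (⊛-negˡ (q^ suc s) G n))))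
        (≡[]-trans (≡[]-⊕ (≡[]-⊕ (≡[]-refl 𝟙) (q^-≡[]-𝟘 (suc s + suc s) G (ℕP.m≤m+n (suc s) (suc s))))
                          (≡[]-⊖ (q^-≡[]-𝟘 (suc s) G ℕP.≤-refl)))
                   (≗⇒≡[] (λ n → trans (ℤP.+-identityʳ _) (ℤP.+-identityʳ _))))
      where
      G = geometric (suc s + suc s)

module Frobenius where

  open import Data.Nat using (suc)
  import Data.Integer as ℤ
  open ℤ using (+_)
  import Data.Integer.Properties as ℤP
  open import Relation.Binary.PropositionalEquality
  open import Data.Integer.Tactic.RingSolver using (solve-∀)
  open PowerSeries
  open ⊛-Solver using (solve; _⊜_; _·_)
  open TruncatedCongruence (+ 3)
  open Monomials
  open Factors

  infix 8 _³
  _³ : Series → Series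
  f ³ = f ⊛ f ⊛ f

  ³-cong : ∀ {f g} → f ≗ g → f ³ ≗ g ³
  ³-cong p = ⊛-cong (⊛-cong p p) p

  cube-expansion : ∀ x → (𝟙 ⊕ x) ³ ≗ (𝟙 ⊕ x ³) ⊕ scale (+ 3) (x ⊕ x ⊛ x)
  cube-expansion x n = begin
      ((a ⊛ a) ⊛ a) n
    ≡⟨ ⊛-one+ x (a ⊛ a) n ⟩
      (a ⊛ a) n ℤ.+ ((a ⊛ a) ⊛ x) n
    ≡⟨ cong₂ ℤ._+_ (⊛-one+ x a n) (⊛-cong (⊛-one+ x a) (λ _ → refl) n) ⟩
      (a n ℤ.+ (a ⊛ x) n) ℤ.+ ((a ⊕ a ⊛ x) ⊛ x) n
    ≡⟨ cong₂ ℤ._+_ (cong (ℤ._+_ (a n)) (one+-⊛ x x n)) (⊛-distribʳ a (a ⊛ x) x n) ⟩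
      (a n ℤ.+ (x n ℤ.+ x² n)) ℤ.+ ((a ⊛ x) n ℤ.+ ((a ⊛ x) ⊛ x) n)
    ≡⟨ cong₂ (λ p r → (a n ℤ.+ (x n ℤ.+ x² n)) ℤ.+ (p ℤ.+ r)) (one+-⊛ x x n) (⊛-cong (one+-⊛ x x) (λ _ → refl) n) ⟩
      (a n ℤ.+ (x n ℤ.+ x² n)) ℤ.+ ((x n ℤ.+ x² n) ℤ.+ ((x ⊕ x²) ⊛ x) n)
    ≡⟨ cong (λ r → (a n ℤ.+ (x n ℤ.+ x² n)) ℤ.+ ((x n ℤ.+ x² n) ℤ.+ r)) (⊛-distribʳ x x² x n) ⟩
      ((𝟙 n ℤ.+ x n) ℤ.+ (x n ℤ.+ x² n)) ℤ.+ ((x n ℤ.+ x² n) ℤ.+ (x² n ℤ.+ (x ³) n))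
    ≡⟨ collect (𝟙 n) (x n) (x² n) ((x ³) n) ⟩
      ((𝟙 ⊕ x ³) ⊕ scale (+ 3) (x ⊕ x²)) n ∎
    where
    open ≡-Reasoning
    a = 𝟙 ⊕ x
    x² = x ⊛ x
    collect : ∀ o p r s → ((o ℤ.+ p) ℤ.+ (p ℤ.+ r)) ℤ.+ ((p ℤ.+ r) ℤ.+ (r ℤ.+ s))
                          ≡ (o ℤ.+ s) ℤ.+ + 3 ℤ.* (p ℤ.+ r)
    collect = solve-∀

  one+-³ : ∀ {E} x → (𝟙 ⊕ x) ³ ≡[ E ] 𝟙 ⊕ x ³
  one+-³ x = ≡[]-trans (≗⇒≡[] (cube-expansion x)) (≡[]-multiple (𝟙 ⊕ x ³) (x ⊕ x ⊛ x))

  ³-product : ∀ f g → (f ⊛ g) ⊛ (f ⊛ g) ⊛ (f ⊛ g) ≗ (f ⊛ f ⊛ f) ⊛ (g ⊛ g ⊛ g)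
  ³-product = solve 2 (λ f g → (((f · g) · (f · g)) · (f · g)) ⊜ (((f · f) · f) · ((g · g) · g))) (λ _ → refl)

  ³-neg : ∀ f → (⊖ f) ⊛ (⊖ f) ⊛ (⊖ f) ≗ ⊖ (f ⊛ f ⊛ f)
  ³-neg f n = begin
      (((⊖ f) ⊛ (⊖ f)) ⊛ (⊖ f)) n
    ≡⟨ ⊛-cong (λ m → trans (⊛-negˡ f (⊖ f) m) (trans (cong ℤ.-_ (⊛-negʳ f f m)) (ℤP.neg-involutive _))) (λ _ → refl) n ⟩
      ((f ⊛ f) ⊛ (⊖ f)) n
    ≡⟨ ⊛-negʳ (f ⊛ f) f n ⟩
      ℤ.- ((f ⊛ f ⊛ f) n) ∎
    where open ≡-Reasoning

  q^-³ : ∀ s → (q^ s) ³ ≗ q^ (s + s + s)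
  q^-³ s n = trans (⊛-cong (q^-+ s s) (λ _ → refl) n) (q^-+ (s + s) s n)

  one+q^-³ : ∀ {E} s → (𝟙 ⊕ q^ s) ³ ≡[ E ] 𝟙 ⊕ q^ (s + s + s)
  one+q^-³ s = ≡[]-trans (one+-³ (q^ s)) (≗⇒≡[] (λ n → cong (ℤ._+_ (𝟙 n)) (q^-³ s n)))

  one-q^-³ : ∀ {E} s → (𝟙 ⊕ ⊖ q^ s) ³ ≡[ E ] 𝟙 ⊕ ⊖ q^ (s + s + s)
  one-q^-³ s = ≡[]-trans (one+-³ (⊖ q^ s))
    (≗⇒≡[] (λ n → cong (ℤ._+_ (𝟙 n)) (trans (³-neg (q^ s) n) (cong ℤ.-_ (q^-³ s n)))))

  -- 1/(1 - qˢ)³ ≡ 1/(1 - q³ˢ): multiply by (1 - q³ˢ)/(1 - q³ˢ) and use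
  -- (1 - qˢ)³ ≡ 1 - q³ˢ
  geometric-³ : ∀ {E} s → (geometric (suc s)) ³ ≡[ E ] geometric (suc s + suc s + suc s)
  geometric-³ s =
    ≡[]-trans (≗⇒≡[] (λ n → sym (trans (⊛-cong (λ _ → refl) (geometric-inverse s3) n) (⊛-identityʳ _ n))))
    (≡[]-trans (≡[]-⊛ʳ (G ³) (≡[]-⊛ˡ G3 (≡[]-sym (one-q^-³ (suc s)))))
    (≗⇒≡[] (λ n → trans (regroup G u G3 n)
       (trans (⊛-cong (λ m → trans (³-cong (geometric-inverse s) m) (trans (⊛-identityʳ _ m) (⊛-identityˡ 𝟙 m))) (λ _ → refl) n)
              (⊛-identityˡ G3 n)))))
    where
    s3 = s + suc s + suc s
    G = geometric (suc s)
    G3 = geometric (suc s3)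
    u = 𝟙 ⊕ ⊖ q^ suc s
    regroup : ∀ (G u G3 : Series) → G ³ ⊛ (u ³ ⊛ G3) ≗ (u ⊛ G) ³ ⊛ G3
    regroup = solve 3 (λ G u G3 → (((G · G) · G) · (((u · u) · u) · G3)) ⊜ ((((u · G) · (u · G)) · (u · G)) · G3)) (λ _ → refl)

  P-³ : ∀ {E} s → P (suc s) ³ ≡[ E ] P (suc s + suc s + suc s)
  P-³ s = ≡[]-trans (≗⇒≡[] (³-product (𝟙 ⊕ q^ suc s) (geometric (suc s))))
                    (≡[]-⊛ (one+q^-³ (suc s)) (geometric-³ s))

-- The counting function of Defs is the coefficient sequence of
--     ∏_{s ≥ 1} F(s),  F(s) = 1 + marks(s) · qˢ/(1 - qˢ)  if k ∤ s,  F(s) = 1 otherwise,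
-- where marks(s) ∈ {1, 2} is the number of ways to mark the first
-- occurrence of s.  For k = 3, i = 1 every allowed part may be overlined
-- and F(s) = P(s).
module Counting where

  open import Data.Nat using (zero; suc; z≤n; s≤s; _≤_; _∸_; _≤ᵇ_; NonZero)
  import Data.Nat.Properties as ℕP
  open import Data.Nat.DivMod using (_%_; m%n<n)
  import Data.Integer as ℤ
  open ℤ using (+_)
  import Data.Integer.Properties as ℤP
  open import Data.Integer.Tactic.RingSolver using (solve-∀)
  open import Relation.Binary.PropositionalEquality
  open import Relation.Nullary using (does)
  open import Data.Bool using (true; false; if_then_else_; _∨_; T)
  open import Data.List using (map; applyUpTo)
  open import Data.Nat.ListAction using (sum)
  open import Function using (_∘_; id)
  open import Data.Empty using (⊥-elim)
  open PowerSeries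
  open ⊛-Solver using (solve; _⊜_; _·_)
  open Monomials
  open Products
  open Factors

  Σ< : (ℕ → ℕ) → ℕ → ℕ
  Σ< t zero = 0
  Σ< t (suc n) = t 0 + Σ< (t ∘ suc) n

  -- Defs sums over multiplicities with a list sum over 'upTo n'
  sum-applyUpTo : ∀ (t g : ℕ → ℕ) n → sum (map t (applyUpTo g n)) ≡ Σ< (t ∘ g) n
  sum-applyUpTo t g zero = refl
  sum-applyUpTo t g (suc n) = cong (_+_ (t (g 0))) (sum-applyUpTo t (g ∘ suc) n)

  Σ<-cong : ∀ {t u : ℕ → ℕ} n → (∀ j → t j ≡ u j) → Σ< t n ≡ Σ< u n
  Σ<-cong zero p = refl
  Σ<-cong (suc n) p = cong₂ _+_ (p 0) (Σ<-cong n (p ∘ suc))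

  Σ<-truncate : ∀ t m k → (∀ j → m ≤ j → t j ≡ 0) → Σ< t (m + k) ≡ Σ< t m
  Σ<-truncate t zero k p = vanish t k (λ j → p j z≤n)
    where
    vanish : ∀ t n → (∀ j → t j ≡ 0) → Σ< t n ≡ 0
    vanish t zero p = refl
    vanish t (suc n) p = cong₂ _+_ (p 0) (vanish (t ∘ suc) n (p ∘ suc))
  Σ<-truncate t (suc m) k p = cong (_+_ (t 0)) (Σ<-truncate (t ∘ suc) m k (λ j l → p (suc j) (s≤s l)))

  ≤ᵇ-false : ∀ a b → b < a → (a ≤ᵇ b) ≡ false
  ≤ᵇ-false a b l with a ≤ᵇ b in eq
  ... | false = refl
  ... | true = ⊥-elim (ℕP.<⇒≱ l (ℕP.≤ᵇ⇒≤ a b (subst T (sym eq) _)))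

  ≤ᵇ-true : ∀ a b → a ≤ b → (a ≤ᵇ b) ≡ true
  ≤ᵇ-true a b l with a ≤ᵇ b in eq
  ... | true = refl
  ... | false = ⊥-elim (subst T eq (ℕP.≤⇒≤ᵇ l))

  ≤ᵇ-+ : ∀ s x y → (s + x ≤ᵇ s + y) ≡ (x ≤ᵇ y)
  ≤ᵇ-+ zero x y = refl
  ≤ᵇ-+ (suc s) x y = trans (suc-≤ᵇ (s + x) (s + y)) (≤ᵇ-+ s x y)
    where
    suc-≤ᵇ : ∀ a b → (suc a ≤ᵇ suc b) ≡ (a ≤ᵇ b)
    suc-≤ᵇ zero b = refl
    suc-≤ᵇ (suc a) b = refl

  -- the number of objects of size n made of j + 1 copies of a part s and
  -- an object of size n - (j + 1)s counted by c: the summand of Defs.cnt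
  multipleTerm : (ℕ → ℕ) → ℕ → ℕ → ℕ → ℕ
  multipleTerm c s n j = if suc j * s ≤ᵇ n then c (n ∸ suc j * s) else 0

  multiples : (ℕ → ℕ) → ℕ → ℕ → ℕ
  multiples c s n = Σ< (multipleTerm c s n) n

  multiples-below : ∀ c s n → n < s → multiples c s n ≡ 0
  multiples-below c s n l = Σ<-truncate _ 0 n λ j _ →
    cong (λ b → if b then c (n ∸ suc j * s) else 0) (≤ᵇ-false (suc j * s) n (ℕP.<-≤-trans l (ℕP.m≤m+n s (j * s))))

  multiples-step : ∀ c s m → multiples c (suc s) (suc s + m) ≡ c m + multiples c (suc s) m
  multiples-step c s m =
    cong₂ _+_ first (trans (Σ<-cong (s + m) later)
                    (trans (cong (Σ< (multipleTerm c (suc s) m)) (ℕP.+-comm s m))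
                           (Σ<-truncate _ m s beyond)))
    where
    first : multipleTerm c (suc s) (suc s + m) 0 ≡ c m
    first = trans (cong (λ b → if b then c ((suc s + m) ∸ (suc s + 0)) else 0)
                        (≤ᵇ-true (suc s + 0) (suc s + m) (ℕP.+-monoʳ-≤ (suc s) z≤n)))
                  (cong c (ℕP.[m+n]∸[m+o]≡n∸o (suc s) m 0))
    later : ∀ j → multipleTerm c (suc s) (suc s + m) (suc j) ≡ multipleTerm c (suc s) m j
    later j rewrite ≤ᵇ-+ (suc s) (suc j * suc s) m | ℕP.[m+n]∸[m+o]≡n∸o (suc s) m (suc j * suc s) = refl
    beyond : ∀ j → m ≤ j → multipleTerm c (suc s) m j ≡ 0
    beyond j l = cong (λ b → if b then c (m ∸ suc j * suc s) else 0)
                      (≤ᵇ-false (suc j * suc s) m (ℕP.<-≤-trans (s≤s l) (ℕP.m≤m*n (suc j) (suc s))))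

  ⊛-multiples : ∀ f c s → (∀ n → f n ≡ + c n) → ∀ n → (f ⊛ (q^ suc s ⊛ geometric (suc s))) n ≡ + multiples c (suc s) n
  ⊛-multiples f c s f≡c n = go n n ℕP.≤-refl
    where
    commute : f ⊛ (q^ suc s ⊛ geometric (suc s)) ≗ q^ suc s ⊛ (f ⊛ geometric (suc s))
    commute = solve 3 (λ f x g → (f · (x · g)) ⊜ (x · (f · g))) (λ _ → refl) f (q^ suc s) (geometric (suc s))
    unfold : f ⊛ geometric (suc s) ≗ f ⊕ f ⊛ (q^ suc s ⊛ geometric (suc s))
    unfold n = trans (⊛-cong (λ _ → refl) (geometric-unfold s) n) (⊛-one+ _ f n)
    -- recursion on n, bounded by the fuel B
    go : ∀ B n → n ≤ B → (f ⊛ (q^ suc s ⊛ geometric (suc s))) n ≡ + multiples c (suc s) n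
    go B n n≤B with threshold (suc s) n
    ... | below l = trans (commute n) (trans (q^-⊛-below (suc s) _ n l) (cong +_ (sym (multiples-below c (suc s) n l))))
    go (suc B) .(suc s + m) (s≤s n≤B) | above m =
      trans (commute (suc s + m)) (trans (q^-⊛-above (suc s) _ m) (trans (unfold m)
        (trans (cong₂ ℤ._+_ (f≡c m) (go B m (ℕP.≤-trans (ℕP.m≤n+m m s) n≤B)))
               (trans (sym (ℤP.pos-+ (c m) (multiples c (suc s) m))) (cong +_ (sym (multiples-step c s m)))))))

  module _ (k i : ℕ) .{{_ : NonZero k}} where

    partFactor : ℕ → Series
    partFactor s =
      if allowed k s then 𝟙 ⊕ scale (+ marks (overlinable k i s)) (q^ s ⊛ geometric s) else 𝟙

    generatingProduct : ℕ → Series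
    generatingProduct m = ∏ (λ j → partFactor (suc j)) m

    cnt-suc : ∀ n m → cnt k i n (suc m) ≡
      (if allowed k (suc m)
       then cnt k i n m + marks (overlinable k i (suc m)) * multiples (λ n′ → cnt k i n′ m) (suc m) n
       else cnt k i n m)
    cnt-suc zero m = refl
    cnt-suc (suc n) m =
      cong (λ u → if allowed k (suc m) then cnt k i (suc n) m + marks (overlinable k i (suc m)) * u else cnt k i (suc n) m)
           (sum-applyUpTo (multipleTerm (λ n′ → cnt k i n′ m) (suc m) (suc n)) id (suc n))

    cnt-∏ : ∀ m n → + cnt k i n m ≡ generatingProduct m n
    cnt-∏ zero zero = refl
    cnt-∏ zero (suc n) = refl
    cnt-∏ (suc m) n rewrite cnt-suc n m with allowed k (suc m)
    ... | false = trans (cnt-∏ m n) (sym (⊛-identityʳ _ n))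
    ... | true = begin
        + (cnt k i n m + c * multiples (λ n′ → cnt k i n′ m) (suc m) n)
      ≡⟨ trans (ℤP.pos-+ (cnt k i n m) _) (cong (ℤ._+_ (+ cnt k i n m)) (ℤP.pos-* c _)) ⟩
        + cnt k i n m ℤ.+ + c ℤ.* + multiples (λ n′ → cnt k i n′ m) (suc m) n
      ≡⟨ cong₂ (λ a b → a ℤ.+ + c ℤ.* b) (cnt-∏ m n) (sym (⊛-multiples (generatingProduct m) _ m (λ n′ → sym (cnt-∏ m n′)) n)) ⟩
        generatingProduct m n ℤ.+ + c ℤ.* (generatingProduct m ⊛ R) n
      ≡⟨ sym (trans (⊛-one+ (scale (+ c) R) (generatingProduct m) n) (cong (ℤ._+_ (generatingProduct m n)) (⊛-scaleʳ _ (+ c) R n))) ⟩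
        (generatingProduct m ⊛ (𝟙 ⊕ scale (+ c) R)) n ∎
      where
      open ≡-Reasoning
      c = marks (overlinable k i (suc m))
      R = q^ suc m ⊛ geometric (suc m)

  allowed⇒overlinable : ∀ s → allowed 3 s ≡ true → overlinable 3 1 s ≡ true
  allowed⇒overlinable s = residue (s % 3) (m%n<n s 3)
    where
    residue : ∀ r → r < 3 → (if does (r ℕP.≟ 0) then false else true) ≡ true →
              (does (r ℕP.≟ 1) ∨ does (r ℕP.≟ 2)) ≡ true
    residue zero _ ()
    residue (suc zero) _ _ = refl
    residue (suc (suc zero)) _ _ = refl
    residue (suc (suc (suc r))) (s≤s (s≤s (s≤s ()))) _

  GF : ℕ → Series
  GF m = ∏ (λ j → if allowed 3 (suc j) then P (suc j) else 𝟙) m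

  -- for k = 3, i = 1 the factors are those of GF, by P(s) = 1 + 2qˢ/(1 - qˢ)
  partFactor-3-1 : ∀ s → partFactor 3 1 (suc s) ≗ (if allowed 3 (suc s) then P (suc s) else 𝟙)
  partFactor-3-1 s with allowed 3 (suc s) in eq
  ... | false = λ _ → refl
  ... | true rewrite allowed⇒overlinable (suc s) eq = λ n →
    trans (cong (ℤ._+_ (𝟙 n)) (double ((q^ suc s ⊛ geometric (suc s)) n))) (sym (P-unfold s n))
    where
    double : ∀ a → + 2 ℤ.* a ≡ a ℤ.+ a
    double = solve-∀

  Cbar-GF : ∀ n → + Cbar 3 1 n ≡ GF n n
  Cbar-GF n = trans (cnt-∏ 3 1 n n) (∏-cong n (λ j _ → partFactor-3-1 j) n)

-- Reduction modulo 3 to a square:  GF ≡ B²  where B = ∏_s P(s)⁻¹.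
-- With A = ∏_s P(s) and T = ∏_{3 ∣ s} P(s) we have GF · T = A, and
-- T = ∏_s P(3s) ≡ A³ by the Frobenius congruence; hence
-- GF = GF · (AB)³ ≡ GF · T · B³ = A B³ = B².  Each product is cut off
-- at part size M, which leaves the coefficients below M + 1 unchanged.
module ReductionToSquare where

  open import Data.Nat using (zero; suc; s≤s; _≤_)
  import Data.Nat.Properties as ℕP
  open import Data.Nat.DivMod using ([m+kn]%n≡m%n)
  import Data.Nat.Tactic.RingSolver as ℕSolver
  open import Data.Integer using (+_)
  open import Relation.Binary.PropositionalEquality
  open import Relation.Nullary using (does)
  open import Data.Bool using (true; false; if_then_else_)
  open PowerSeries
  open ⊛-Solver using (solve; _⊜_; _·_)
  open TruncatedCongruence (+ 3)
  open Products
  open Factors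
  open Frobenius
  open Counting using (GF)

  A B : ℕ → Series
  A m = ∏ (λ j → P (suc j)) m
  B m = ∏ (λ j → P⁻¹ (suc j)) m

  excluded : ℕ → Series
  excluded s = if allowed 3 s then 𝟙 else P s

  T : ℕ → Series
  T m = ∏ (λ j → excluded (suc j)) m

  A⊛B : ∀ m → A m ⊛ B m ≗ 𝟙
  A⊛B m = ∏-inverse _ _ m P-inverse

  GF⊛T : ∀ m → GF m ⊛ T m ≗ A m
  GF⊛T m n = trans (∏-⊛ _ _ m n) (∏-cong m (λ j _ → complementary (suc j)) n)
    where
    complementary : ∀ s → (if allowed 3 s then P s else 𝟙) ⊛ excluded s ≗ P s
    complementary s with allowed 3 s
    ... | true = ⊛-identityʳ (P s)
    ... | false = ⊛-identityˡ (P s)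

  A-³ : ∀ {E} m → A m ³ ≡[ E ] ∏ (λ j → P (suc j + suc j + suc j)) m
  A-³ m = ≡[]-trans (≗⇒≡[] (λ n → trans (⊛-cong (∏-⊛ _ _ m) (λ _ → refl) n) (∏-⊛ _ _ m n)))
                    (∏-≡[] m (λ j _ → P-³ j))

  allowed-periodic : ∀ a m → allowed 3 (a + m * 3) ≡ allowed 3 a
  allowed-periodic a m = cong (λ r → if does (r ℕP.≟ 0) then false else true) ([m+kn]%n≡m%n a m 3)

  excluded-1 : ∀ m → excluded (1 + m * 3) ≡ 𝟙
  excluded-1 m rewrite allowed-periodic 1 m = refl

  excluded-2 : ∀ m → excluded (2 + m * 3) ≡ 𝟙
  excluded-2 m rewrite allowed-periodic 2 m = refl

  excluded-3 : ∀ m → excluded (3 + m * 3) ≡ P (suc m + suc m + suc m)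
  excluded-3 m rewrite allowed-periodic 3 m = cong P (block-index m)
    where
    block-index : ∀ m → 3 + m * 3 ≡ suc m + suc m + suc m
    block-index = ℕSolver.solve-∀

  T-blocks : ∀ m → T (m * 3) ≗ ∏ (λ j → P (suc j + suc j + suc j)) m
  T-blocks zero = λ _ → refl
  T-blocks (suc m) n rewrite excluded-1 m | excluded-2 m | excluded-3 m =
    ⊛-cong (λ k → trans (⊛-identityʳ _ k) (trans (⊛-identityʳ _ k) (T-blocks m k))) (λ _ → refl) n

  T-truncate : ∀ M → T (M * 3) ≡[ suc M ] T M
  T-truncate M = ∏-extend _ M (M * 3) (ℕP.m≤m*n M 3) excluded-≡[]-𝟙
    where
    excluded-≡[]-𝟙 : ∀ j → M ≤ j → excluded (suc j) ≡[ suc M ] 𝟙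
    excluded-≡[]-𝟙 j M≤j with allowed 3 (suc j)
    ... | true = ≡[]-refl 𝟙
    ... | false = ≡[]-weaken (s≤s M≤j) (P-≡[]-𝟙 j)

  GF-≡[]-B² : ∀ M → GF M ≡[ suc M ] B M ⊛ B M
  GF-≡[]-B² M = begin
      GF M                                 ≗⟨ ⊛-identityʳ (GF M) ⟨
      GF M ⊛ 𝟙                             ≗⟨ ⊛-cong (λ _ → refl) (λ n → trans (³-cong (A⊛B M) n) (𝟙-³ n)) ⟨
      GF M ⊛ (A M ⊛ B M) ³                 ≗⟨ regroup (GF M) (A M) (B M) ⟩
      (GF M ⊛ A M ³) ⊛ B M ³               ≈⟨ ≡[]-⊛ˡ (B M ³) (≡[]-⊛ʳ (GF M) (A-³ M)) ⟩
      (GF M ⊛ ∏ (λ j → P (suc j + suc j + suc j)) M) ⊛ B M ³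
                                           ≗⟨ ⊛-cong (⊛-cong (λ _ → refl) (T-blocks M)) (λ _ → refl) ⟨
      (GF M ⊛ T (M * 3)) ⊛ B M ³           ≈⟨ ≡[]-⊛ˡ (B M ³) (≡[]-⊛ʳ (GF M) (T-truncate M)) ⟩
      (GF M ⊛ T M) ⊛ B M ³                 ≗⟨ ⊛-cong (GF⊛T M) (λ _ → refl) ⟩
      A M ⊛ B M ³                          ≗⟨ regroup′ (A M) (B M) ⟩
      (A M ⊛ B M) ⊛ (B M ⊛ B M)            ≗⟨ ⊛-cong (A⊛B M) (λ _ → refl) ⟩
      𝟙 ⊛ (B M ⊛ B M)                      ≗⟨ ⊛-identityˡ _ ⟩
      B M ⊛ B M                            ∎
    where
    open ≡[]-Reasoning (suc M)
    𝟙-³ : 𝟙 ³ ≗ 𝟙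
    𝟙-³ n = trans (⊛-identityʳ (𝟙 ⊛ 𝟙) n) (⊛-identityˡ 𝟙 n)
    regroup : ∀ (g a b : Series) → g ⊛ ((a ⊛ b) ⊛ (a ⊛ b) ⊛ (a ⊛ b)) ≗ (g ⊛ (a ⊛ a ⊛ a)) ⊛ (b ⊛ b ⊛ b)
    regroup = solve 3 (λ g a b → (g · (((a · b) · (a · b)) · (a · b))) ⊜ ((g · ((a · a) · a)) · ((b · b) · b))) (λ _ → refl)
    regroup′ : ∀ (a b : Series) → a ⊛ (b ⊛ b ⊛ b) ≗ (a ⊛ b) ⊛ (b ⊛ b)
    regroup′ = solve 2 (λ a b → (a · ((b · b) · b)) ⊜ ((a · b) · (b · b))) (λ _ → refl)

-- Gaussian binomial coefficients in the base q²:
--     [n, k] = Π_{i<k} (1 - q^{2(n-i)}) / (1 - q^{2(i+1)}),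
-- introduced through Pascal's recurrence.
module GaussianBinomials where

  open import Data.Nat using (zero; suc; s≤s; _≤_; _∸_)
  import Data.Nat.Properties as ℕP
  import Data.Nat.Tactic.RingSolver as ℕSolver
  import Data.Integer as ℤ
  open ℤ using (+_)
  import Data.Integer.Properties as ℤP
  open import Data.Integer.Tactic.RingSolver using (solve-∀)
  open import Relation.Binary.PropositionalEquality
  open import Relation.Nullary using (yes; no)
  open import Data.Sum using (inj₁; inj₂)
  open PowerSeries
  open ⊛-Solver using (solve; _⊜_; _·_)
  open Monomials
  open Products

  q²^_ : ℕ → Series
  q²^ k = q^ (k + k)

  q²^-+ : ∀ a b → q²^ a ⊛ q²^ b ≗ q²^ (a + b)
  q²^-+ a b n = trans (q^-+ (a + a) (b + b) n) (q^-cong (doubled a b) n)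
    where
    doubled : ∀ a b → (a + a) + (b + b) ≡ (a + b) + (a + b)
    doubled = ℕSolver.solve-∀

  gaussian : ℕ → ℕ → Series
  gaussian n zero = 𝟙
  gaussian zero (suc k) = 𝟘
  gaussian (suc n) (suc k) = gaussian n k ⊕ q²^ suc k ⊛ gaussian n (suc k)

  gaussian-vanish : ∀ n k → n < k → gaussian n k ≗ 𝟘
  gaussian-vanish zero (suc k) _ = λ _ → refl
  gaussian-vanish (suc n) (suc k) (s≤s l) t =
    cong₂ ℤ._+_ (gaussian-vanish n k l t) (⊛-vanishʳ _ (gaussian-vanish n (suc k) (ℕP.m<n⇒m<1+n l)) t)

  previous : (ℕ → Series) → ℕ → Series
  previous f zero = 𝟘
  previous f (suc k) = f k

  -- monomial factors in front of [n, k] may be redistributed freely as long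
  -- as the total degree is kept, and arbitrarily when k > n ([n, k] = 0)
  q^-exchange : ∀ a b c d n k → (k ≤ n → a + b ≡ c + d) →
                q^ a ⊛ (q^ b ⊛ gaussian n k) ≗ q^ c ⊛ (q^ d ⊛ gaussian n k)
  q^-exchange a b c d n k same-degree with k ℕP.≤? n
  ... | yes k≤n = λ t → trans (q^-⊛-q^ a b g t)
                           (trans (⊛-congˡ g (q^-cong (same-degree k≤n)) t) (sym (q^-⊛-q^ c d g t)))
    where g = gaussian n k
  ... | no k≰n = λ t → trans (⊛-vanishʳ _ (⊛-vanishʳ _ vanishes) t) (sym (⊛-vanishʳ _ (⊛-vanishʳ _ vanishes) t))
    where vanishes = gaussian-vanish n k (ℕP.≰⇒> k≰n)

  q²^-⊛-gaussian : ∀ a b c n k → (k ≤ n → a + b ≡ c) → q²^ a ⊛ (q²^ b ⊛ gaussian n k) ≗ q²^ c ⊛ gaussian n k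
  q²^-⊛-gaussian a b c n k a+b≡c t =
    trans (q^-exchange (a + a) (b + b) (c + c) 0 n k (λ k≤n → trans (doubled a b) (trans (cong (λ e → e + e) (a+b≡c k≤n)) (sym (ℕP.+-identityʳ _)))) t)
          (⊛-congʳ (q²^ c) (⊛-identityˡ (gaussian n k)) t)
    where
    doubled : ∀ a b → (a + a) + (b + b) ≡ (a + b) + (a + b)
    doubled = ℕSolver.solve-∀

  exponent-swap : ∀ n k → q²^ suc (suc k) ⊛ (q²^ (n ∸ suc k) ⊛ gaussian n (suc k))
                         ≗ q²^ (n ∸ k) ⊛ (q²^ suc k ⊛ gaussian n (suc k))
  exponent-swap n k t =
    trans (q²^-⊛-gaussian (suc (suc k)) (n ∸ suc k) (suc n) n (suc k) (λ k<n → cong suc (ℕP.m+[n∸m]≡n k<n)) t)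
          (sym (q²^-⊛-gaussian (n ∸ k) (suc k) (suc n) n (suc k)
                 (λ k<n → trans (ℕP.+-suc (n ∸ k) k) (cong suc (ℕP.m∸n+n≡m (ℕP.<⇒≤ k<n)))) t))

  gaussian-pascal′ : ∀ n k → gaussian (suc n) (suc k) ≗ q²^ (n ∸ k) ⊛ gaussian n k ⊕ gaussian n (suc k)
  gaussian-pascal′ zero zero t =
    trans (cong (ℤ._+_ (𝟙 t)) (⊛-zeroʳ (q²^ 1) t)) (cong (λ z → z ℤ.+ + 0) (sym (⊛-identityˡ 𝟙 t)))
  gaussian-pascal′ zero (suc k) t =
    trans (cong (ℤ._+_ (+ 0)) (⊛-zeroʳ (q²^ suc (suc k)) t)) (cong (λ z → z ℤ.+ + 0) (sym (⊛-zeroʳ (q²^ 0) t)))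
  gaussian-pascal′ (suc n) zero = begin
      𝟙 ⊕ q²^ 1 ⊛ gaussian (suc n) 1                       ≈⟨ ⊕-congʳ 𝟙 (⊛-congʳ (q²^ 1) (gaussian-pascal′ n zero)) ⟩
      𝟙 ⊕ q²^ 1 ⊛ (q²^ n ⊛ 𝟙 ⊕ gaussian n 1)               ≈⟨ ⊕-congʳ 𝟙 (⊛-distribˡ (q²^ 1) _ _) ⟩
      𝟙 ⊕ (q²^ 1 ⊛ (q²^ n ⊛ 𝟙) ⊕ q²^ 1 ⊛ gaussian n 1)     ≈⟨ ⊕-congʳ 𝟙 (⊕-congˡ (q²^ 1 ⊛ gaussian n 1) top) ⟩
      𝟙 ⊕ (q²^ suc n ⊛ 𝟙 ⊕ q²^ 1 ⊛ gaussian n 1)           ≈⟨ swap 𝟙 (q²^ suc n ⊛ 𝟙) (q²^ 1 ⊛ gaussian n 1) ⟩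
      q²^ suc n ⊛ 𝟙 ⊕ (𝟙 ⊕ q²^ 1 ⊛ gaussian n 1)           ∎
    where
    open ≗-Reasoning
    top : q²^ 1 ⊛ (q²^ n ⊛ 𝟙) ≗ q²^ suc n ⊛ 𝟙
    top t = trans (⊛-congʳ (q²^ 1) (⊛-identityʳ (q²^ n)) t) (trans (q²^-+ 1 n t) (sym (⊛-identityʳ _ t)))
    swap : ∀ a b c → a ⊕ (b ⊕ c) ≗ b ⊕ (a ⊕ c)
    swap a b c t = left-swap (a t) (b t) (c t)
      where
      left-swap : ∀ a b c → a ℤ.+ (b ℤ.+ c) ≡ b ℤ.+ (a ℤ.+ c)
      left-swap = solve-∀
  gaussian-pascal′ (suc n) (suc k) = begin
      gaussian (suc n) (suc k) ⊕ Y ⊛ gaussian (suc n) (suc (suc k))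
        ≈⟨ ⊕-cong (gaussian-pascal′ n k) (⊛-congʳ Y (gaussian-pascal′ n (suc k))) ⟩
      (q²^ (n ∸ k) ⊛ gaussian n k ⊕ gaussian n (suc k)) ⊕ Y ⊛ (q²^ (n ∸ suc k) ⊛ gaussian n (suc k) ⊕ gaussian n (suc (suc k)))
        ≈⟨ ⊕-congʳ A (⊛-distribˡ Y _ _) ⟩
      (q²^ (n ∸ k) ⊛ gaussian n k ⊕ gaussian n (suc k)) ⊕ (Y ⊛ (q²^ (n ∸ suc k) ⊛ gaussian n (suc k)) ⊕ Y ⊛ gaussian n (suc (suc k)))
        ≈⟨ ⊕-congʳ A (⊕-congˡ (Y ⊛ gaussian n (suc (suc k))) (exponent-swap n k)) ⟩
      (q²^ (n ∸ k) ⊛ gaussian n k ⊕ gaussian n (suc k)) ⊕ (q²^ (n ∸ k) ⊛ (q²^ suc k ⊛ gaussian n (suc k)) ⊕ Y ⊛ gaussian n (suc (suc k)))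
        ≈⟨ ⊕-interchange (q²^ (n ∸ k) ⊛ gaussian n k) (gaussian n (suc k))
                         (q²^ (n ∸ k) ⊛ (q²^ suc k ⊛ gaussian n (suc k))) (Y ⊛ gaussian n (suc (suc k))) ⟩
      (q²^ (n ∸ k) ⊛ gaussian n k ⊕ q²^ (n ∸ k) ⊛ (q²^ suc k ⊛ gaussian n (suc k))) ⊕ gaussian (suc n) (suc (suc k))
        ≈⟨ ⊕-congˡ (gaussian (suc n) (suc (suc k))) (⊛-distribˡ (q²^ (n ∸ k)) _ _) ⟨
      q²^ (n ∸ k) ⊛ gaussian (suc n) (suc k) ⊕ gaussian (suc n) (suc (suc k)) ∎
    where
    open ≗-Reasoning
    Y = q²^ suc (suc k)
    A = q²^ (n ∸ k) ⊛ gaussian n k ⊕ gaussian n (suc k)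

  gaussian-pascal-previous : ∀ n k → gaussian (suc n) k ≗ q²^ (suc n ∸ k) ⊛ previous (gaussian n) k ⊕ gaussian n k
  gaussian-pascal-previous n zero t = sym (trans (cong (λ z → z ℤ.+ 𝟙 t) (⊛-zeroʳ _ t)) (ℤP.+-identityˡ _))
  gaussian-pascal-previous n (suc k) = gaussian-pascal′ n k

  gaussian-two-step : ∀ n k → gaussian (suc (suc n)) (suc k) ≗
    (𝟙 ⊕ q²^ suc n) ⊛ gaussian n k ⊕ (q²^ (suc n ∸ k) ⊛ previous (gaussian n) k ⊕ q²^ suc k ⊛ gaussian n (suc k))
  gaussian-two-step n k = begin
      gaussian (suc n) k ⊕ Y ⊛ gaussian (suc n) (suc k)
        ≈⟨ ⊕-cong (gaussian-pascal-previous n k) (⊛-congʳ Y (gaussian-pascal′ n k)) ⟩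
      (a ⊕ b) ⊕ Y ⊛ (q²^ (n ∸ k) ⊛ b ⊕ c)
        ≈⟨ ⊕-congʳ (a ⊕ b) (⊛-distribˡ Y _ _) ⟩
      (a ⊕ b) ⊕ (Y ⊛ (q²^ (n ∸ k) ⊛ b) ⊕ Y ⊛ c)
        ≈⟨ ⊕-congʳ (a ⊕ b) (⊕-congˡ (Y ⊛ c) (q²^-⊛-gaussian (suc k) (n ∸ k) (suc n) n k (λ k≤n → cong suc (ℕP.m+[n∸m]≡n k≤n)))) ⟩
      (a ⊕ b) ⊕ (q²^ suc n ⊛ b ⊕ Y ⊛ c)
        ≈⟨ regroup a b (q²^ suc n ⊛ b) (Y ⊛ c) ⟩
      (b ⊕ q²^ suc n ⊛ b) ⊕ (a ⊕ Y ⊛ c)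
        ≈⟨ ⊕-congˡ (a ⊕ Y ⊛ c) (one+-⊛ (q²^ suc n) b) ⟨
      (𝟙 ⊕ q²^ suc n) ⊛ b ⊕ (a ⊕ Y ⊛ c) ∎
    where
    open ≗-Reasoning
    Y = q²^ suc k
    a = q²^ (suc n ∸ k) ⊛ previous (gaussian n) k
    b = gaussian n k
    c = gaussian n (suc k)
    regroup : ∀ a b d e → (a ⊕ b) ⊕ (d ⊕ e) ≗ (b ⊕ d) ⊕ (a ⊕ e)
    regroup a b d e t = rearrange (a t) (b t) (d t) (e t)
      where
      rearrange : ∀ a b d e → (a ℤ.+ b) ℤ.+ (d ℤ.+ e) ≡ (b ℤ.+ d) ℤ.+ (a ℤ.+ e)
      rearrange = solve-∀

  q²Poch : ℕ → Series
  q²Poch n = ∏ (λ i → 𝟙 ⊕ ⊖ q²^ suc i) n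

  telescoping-factor : ∀ n k → k ≤ n → (𝟙 ⊕ ⊖ q²^ suc k) ⊕ q²^ suc k ⊛ (𝟙 ⊕ ⊖ q²^ (n ∸ k)) ≗ 𝟙 ⊕ ⊖ q²^ suc n
  telescoping-factor n k k≤n t =
    trans (cong (ℤ._+_ ((𝟙 ⊕ ⊖ q²^ suc k) t))
                (trans (⊛-one+ (⊖ q²^ (n ∸ k)) (q²^ suc k) t)
                       (cong (ℤ._+_ ((q²^ suc k) t))
                             (trans (⊛-negʳ (q²^ suc k) (q²^ (n ∸ k)) t)
                                    (cong ℤ.-_ (trans (q²^-+ (suc k) (n ∸ k) t) (q^-cong (cong (λ e → e + e) exponent) t)))))))
          (cancel (𝟙 t) ((q²^ suc k) t) ((q²^ suc n) t))
    where
    exponent : suc k + (n ∸ k) ≡ suc n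
    exponent = cong suc (ℕP.m+[n∸m]≡n k≤n)
    cancel : ∀ a y z → (a ℤ.+ ℤ.- y) ℤ.+ (y ℤ.+ ℤ.- z) ≡ a ℤ.+ ℤ.- z
    cancel = solve-∀

  ∸-pred : ∀ {n k} → suc k ≤ n → n ∸ k ≡ suc (n ∸ suc k)
  ∸-pred {suc n} (s≤s k≤n) = ℕP.+-∸-assoc 1 k≤n

  gaussian-product : ∀ n k → k ≤ n → gaussian n k ⊛ q²Poch k ⊛ q²Poch (n ∸ k) ≗ q²Poch n
  gaussian-product n zero _ t = trans (⊛-congˡ (q²Poch n) (⊛-identityˡ 𝟙) t) (⊛-identityˡ _ t)
  gaussian-product (suc n) (suc k) (s≤s k≤n) = begin
      (gaussian n k ⊕ Y ⊛ gaussian n (suc k)) ⊛ q²Poch (suc k) ⊛ q²Poch (n ∸ k)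
        ≈⟨ ⊛-congˡ (q²Poch (n ∸ k)) (⊛-distribʳ (gaussian n k) (Y ⊛ gaussian n (suc k)) (q²Poch (suc k))) ⟩
      (gaussian n k ⊛ q²Poch (suc k) ⊕ (Y ⊛ gaussian n (suc k)) ⊛ q²Poch (suc k)) ⊛ q²Poch (n ∸ k)
        ≈⟨ ⊛-distribʳ _ _ (q²Poch (n ∸ k)) ⟩
      gaussian n k ⊛ q²Poch (suc k) ⊛ q²Poch (n ∸ k) ⊕ (Y ⊛ gaussian n (suc k)) ⊛ q²Poch (suc k) ⊛ q²Poch (n ∸ k)
        ≈⟨ ⊕-cong lower-term upper-term ⟩
      q²Poch n ⊛ (𝟙 ⊕ ⊖ Y) ⊕ q²Poch n ⊛ (Y ⊛ (𝟙 ⊕ ⊖ q²^ (n ∸ k)))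
        ≈⟨ ⊛-distribˡ (q²Poch n) _ _ ⟨
      q²Poch n ⊛ ((𝟙 ⊕ ⊖ Y) ⊕ Y ⊛ (𝟙 ⊕ ⊖ q²^ (n ∸ k)))
        ≈⟨ ⊛-congʳ (q²Poch n) (telescoping-factor n k k≤n) ⟩
      q²Poch n ⊛ (𝟙 ⊕ ⊖ q²^ suc n) ∎
    where
    open ≗-Reasoning
    Y = q²^ suc k
    lower-term : gaussian n k ⊛ q²Poch (suc k) ⊛ q²Poch (n ∸ k) ≗ q²Poch n ⊛ (𝟙 ⊕ ⊖ Y)
    lower-term t = trans (regroup (gaussian n k) (q²Poch k) (q²Poch (n ∸ k)) (𝟙 ⊕ ⊖ Y) t)
                         (⊛-congˡ (𝟙 ⊕ ⊖ Y) (gaussian-product n k k≤n) t)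
      where
      regroup : ∀ (g p r u : Series) → (g ⊛ (p ⊛ u)) ⊛ r ≗ (g ⊛ p ⊛ r) ⊛ u
      regroup = solve 4 (λ g p r u → ((g · (p · u)) · r) ⊜ (((g · p) · r) · u)) (λ _ → refl)
    upper-term : (Y ⊛ gaussian n (suc k)) ⊛ q²Poch (suc k) ⊛ q²Poch (n ∸ k) ≗ q²Poch n ⊛ (Y ⊛ (𝟙 ⊕ ⊖ q²^ (n ∸ k)))
    upper-term with ℕP.≤-<-connex (suc k) n
    ... | inj₁ k<n rewrite ∸-pred k<n = λ t →
      trans (regroup Y (gaussian n (suc k)) (q²Poch (suc k)) (q²Poch (n ∸ suc k)) _ t)
            (⊛-congˡ (Y ⊛ (𝟙 ⊕ ⊖ q²^ suc (n ∸ suc k))) (gaussian-product n (suc k) k<n) t)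
      where
      regroup : ∀ (y g p r u : Series) → ((y ⊛ g) ⊛ p) ⊛ (r ⊛ u) ≗ ((g ⊛ p) ⊛ r) ⊛ (y ⊛ u)
      regroup = solve 5 (λ y g p r u → (((y · g) · p) · (r · u)) ⊜ (((g · p) · r) · (y · u))) (λ _ → refl)
    ... | inj₂ (s≤s n≤k) rewrite ℕP.m≤n⇒m∸n≡0 n≤k = λ t →
      trans (⊛-vanishˡ 𝟙 (⊛-vanishˡ (q²Poch (suc k)) (⊛-vanishʳ Y (gaussian-vanish n (suc k) (s≤s n≤k)))) t)
            (sym (⊛-vanishʳ (q²Poch n) (⊛-vanishʳ Y (λ t → ℤP.+-inverseʳ (𝟙 t))) t))

-- The terms satisfy a
-- three-term recurrence in m (from the two-step Pascal recurrence), under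
-- which the alternating sum gets multiplied by -(1 - q^{2m+1})².
module TripleProduct where

  open import Data.Nat using (zero; suc; _≤_; _∸_)
  import Data.Nat.Properties as ℕP
  import Data.Integer as ℤ
  open ℤ using (ℤ; +_; -[1+_]; ∣_∣)
  import Data.Integer.Properties as ℤP
  open import Data.Integer.Tactic.RingSolver using (solve-∀)
  open import Relation.Binary.PropositionalEquality
  open PowerSeries
  open ⊛-Solver using (solve; _⊜_; _·_)
  open Monomials
  open Products
  open GaussianBinomials

  sq : ℤ → ℕ
  sq z = ∣ z ℤ.* z ∣

  sq-ℤ : ∀ z → + sq z ≡ z ℤ.* z
  sq-ℤ (+ n) = trans (cong (λ z → + ∣ z ∣) (sym (ℤP.pos-* n n))) (ℤP.pos-* n n)
  sq-ℤ -[1+ n ] = refl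

  sqDist : ℕ → ℕ → ℕ
  sqDist m k = sq (+ k ℤ.- + m)

  -- identities between exponents are checked in ℤ
  private
    ∸-ℤ : ∀ {a b} → b ≤ a → + (a ∸ b) ≡ + a ℤ.- + b
    ∸-ℤ {a} {b} le = trans (sym (ℤP.⊖-≥ le)) (sym (ℤP.m-n≡m⊖n a b))

  sqDist-suc-suc : ∀ m k → sqDist (suc m) (suc k) ≡ sqDist m k
  sqDist-suc-suc m k = cong sq (shift-both (+ k) (+ m))
    where
    shift-both : ∀ a b → (+ 1 ℤ.+ a) ℤ.- (+ 1 ℤ.+ b) ≡ a ℤ.- b
    shift-both = solve-∀

  sqDist-step-down : ∀ m k → k ≤ m + m → sqDist m (suc k) + ((m + m ∸ k) + (m + m ∸ k)) ≡ suc (m + m) + sqDist m k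
  sqDist-step-down m k le = ℤP.+-injective (begin
      + (sqDist m (suc k) + ((m + m ∸ k) + (m + m ∸ k)))
    ≡⟨ trans (ℤP.pos-+ (sqDist m (suc k)) _) (cong₂ ℤ._+_ (sq-ℤ (+ suc k ℤ.- + m))
             (trans (ℤP.pos-+ (m + m ∸ k) _) (cong₂ ℤ._+_ (∸-ℤ le) (∸-ℤ le)))) ⟩
      ((+ 1 ℤ.+ + k) ℤ.- + m) ℤ.* ((+ 1 ℤ.+ + k) ℤ.- + m) ℤ.+ (((+ m ℤ.+ + m) ℤ.- + k) ℤ.+ ((+ m ℤ.+ + m) ℤ.- + k))
    ≡⟨ expand (+ k) (+ m) ⟩
      (+ 1 ℤ.+ (+ m ℤ.+ + m)) ℤ.+ (+ k ℤ.- + m) ℤ.* (+ k ℤ.- + m)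
    ≡⟨ cong₂ ℤ._+_ (sym (ℤP.pos-+ 1 (m + m))) (sym (sq-ℤ (+ k ℤ.- + m))) ⟩
      + suc (m + m) ℤ.+ + sqDist m k
    ≡⟨ ℤP.pos-+ (suc (m + m)) (sqDist m k) ⟨
      + (suc (m + m) + sqDist m k) ∎)
    where
    open ≡-Reasoning
    expand : ∀ k m → ((+ 1 ℤ.+ k) ℤ.- m) ℤ.* ((+ 1 ℤ.+ k) ℤ.- m) ℤ.+ (((m ℤ.+ m) ℤ.- k) ℤ.+ ((m ℤ.+ m) ℤ.- k))
                   ≡ (+ 1 ℤ.+ (m ℤ.+ m)) ℤ.+ (k ℤ.- m) ℤ.* (k ℤ.- m)
    expand = solve-∀

  sqDist-step-up : ∀ m k → sqDist m k + (suc k + suc k) ≡ suc (m + m) + sqDist m (suc k)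
  sqDist-step-up m k = ℤP.+-injective (begin
      + (sqDist m k + (suc k + suc k))
    ≡⟨ trans (ℤP.pos-+ (sqDist m k) _) (cong₂ ℤ._+_ (sq-ℤ (+ k ℤ.- + m)) (ℤP.pos-+ (suc k) (suc k))) ⟩
      (+ k ℤ.- + m) ℤ.* (+ k ℤ.- + m) ℤ.+ ((+ 1 ℤ.+ + k) ℤ.+ (+ 1 ℤ.+ + k))
    ≡⟨ expand (+ k) (+ m) ⟩
      (+ 1 ℤ.+ (+ m ℤ.+ + m)) ℤ.+ ((+ 1 ℤ.+ + k) ℤ.- + m) ℤ.* ((+ 1 ℤ.+ + k) ℤ.- + m)
    ≡⟨ cong₂ ℤ._+_ (sym (ℤP.pos-+ 1 (m + m))) (sym (sq-ℤ (+ suc k ℤ.- + m))) ⟩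
      + suc (m + m) ℤ.+ + sqDist m (suc k)
    ≡⟨ ℤP.pos-+ (suc (m + m)) (sqDist m (suc k)) ⟨
      + (suc (m + m) + sqDist m (suc k)) ∎)
    where
    open ≡-Reasoning
    expand : ∀ k m → (k ℤ.- m) ℤ.* (k ℤ.- m) ℤ.+ ((+ 1 ℤ.+ k) ℤ.+ (+ 1 ℤ.+ k))
                   ≡ (+ 1 ℤ.+ (m ℤ.+ m)) ℤ.+ ((+ 1 ℤ.+ k) ℤ.- m) ℤ.* ((+ 1 ℤ.+ k) ℤ.- m)
    expand = solve-∀

  sqDist-zero : ∀ m → sqDist (suc m) 0 ≡ suc (m + m) + sqDist m 0
  sqDist-zero m = ℤP.+-injective (begin
      + sqDist (suc m) 0
    ≡⟨ sq-ℤ (+ 0 ℤ.- + suc m) ⟩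
      (+ 0 ℤ.- (+ 1 ℤ.+ + m)) ℤ.* (+ 0 ℤ.- (+ 1 ℤ.+ + m))
    ≡⟨ expand (+ m) ⟩
      (+ 1 ℤ.+ (+ m ℤ.+ + m)) ℤ.+ (+ 0 ℤ.- + m) ℤ.* (+ 0 ℤ.- + m)
    ≡⟨ cong₂ ℤ._+_ (sym (ℤP.pos-+ 1 (m + m))) (sym (sq-ℤ (+ 0 ℤ.- + m))) ⟩
      + suc (m + m) ℤ.+ + sqDist m 0
    ≡⟨ ℤP.pos-+ (suc (m + m)) (sqDist m 0) ⟨
      + (suc (m + m) + sqDist m 0) ∎)
    where
    open ≡-Reasoning
    expand : ∀ m → (+ 0 ℤ.- (+ 1 ℤ.+ m)) ℤ.* (+ 0 ℤ.- (+ 1 ℤ.+ m)) ≡ (+ 1 ℤ.+ (m ℤ.+ m)) ℤ.+ (+ 0 ℤ.- m) ℤ.* (+ 0 ℤ.- m)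
    expand = solve-∀

  jacobiTerm : ℕ → ℕ → Series
  jacobiTerm m k = q^ sqDist m k ⊛ gaussian (m + m) k

  oddPower : ℕ → Series
  oddPower m = q^ suc (m + m)

  jacobiTerm-recurrence : ∀ m k → jacobiTerm (suc m) k ≗
    (𝟙 ⊕ oddPower m ⊛ oddPower m) ⊛ previous (jacobiTerm m) k
      ⊕ (oddPower m ⊛ previous (previous (jacobiTerm m)) k ⊕ oddPower m ⊛ jacobiTerm m k)
  jacobiTerm-recurrence m zero = begin
      q^ sqDist (suc m) 0 ⊛ 𝟙                   ≈⟨ ⊛-congˡ 𝟙 (q^-cong (sqDist-zero m)) ⟩
      q^ (suc (m + m) + sqDist m 0) ⊛ 𝟙         ≈⟨ q^-⊛-q^ (suc (m + m)) (sqDist m 0) 𝟙 ⟨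
      a ⊛ jacobiTerm m 0                       ≈⟨ (λ t → trans (ℤP.+-identityˡ _) (ℤP.+-identityˡ _)) ⟨
      𝟘 ⊕ (𝟘 ⊕ a ⊛ jacobiTerm m 0)            ≈⟨ ⊕-cong (⊛-zeroʳ (𝟙 ⊕ a ⊛ a)) (⊕-congˡ (a ⊛ jacobiTerm m 0) (⊛-zeroʳ a)) ⟨
      (𝟙 ⊕ a ⊛ a) ⊛ 𝟘 ⊕ (a ⊛ 𝟘 ⊕ a ⊛ jacobiTerm m 0) ∎
    where
    open ≗-Reasoning
    a = oddPower m
  jacobiTerm-recurrence m (suc k) = begin
      q^ sqDist (suc m) (suc k) ⊛ gaussian (suc m + suc m) (suc k)
        ≈⟨ ⊛-cong (q^-cong (sqDist-suc-suc m k)) (λ t → cong (λ z → gaussian z (suc k) t) (cong suc (ℕP.+-suc m m))) ⟩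
      q^ e ⊛ gaussian (suc (suc n)) (suc k)
        ≈⟨ ⊛-congʳ (q^ e) (gaussian-two-step n k) ⟩
      q^ e ⊛ (A₁ ⊕ (A₂ ⊕ A₃))
        ≈⟨ (λ t → trans (⊛-distribˡ (q^ e) A₁ (A₂ ⊕ A₃) t) (⊕-congʳ (q^ e ⊛ A₁) (⊛-distribˡ (q^ e) A₂ A₃) t)) ⟩
      q^ e ⊛ A₁ ⊕ (q^ e ⊛ A₂ ⊕ q^ e ⊛ A₃)
        ≈⟨ ⊕-cong squared-factor (⊕-cong (one-down k) one-up) ⟩
      (𝟙 ⊕ a ⊛ a) ⊛ jacobiTerm m k ⊕ (a ⊛ previous (jacobiTerm m) k ⊕ a ⊛ jacobiTerm m (suc k)) ∎
    where
    open ≗-Reasoning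
    n = m + m
    e = sqDist m k
    a = oddPower m
    A₁ = (𝟙 ⊕ q²^ suc n) ⊛ gaussian n k
    A₂ = q²^ (suc n ∸ k) ⊛ previous (gaussian n) k
    A₃ = q²^ suc k ⊛ gaussian n (suc k)
    squared-factor : q^ e ⊛ ((𝟙 ⊕ q²^ suc n) ⊛ gaussian n k) ≗ (𝟙 ⊕ a ⊛ a) ⊛ jacobiTerm m k
    squared-factor t = trans (commute (q^ e) (𝟙 ⊕ q²^ suc n) (gaussian n k) t)
                             (⊛-congˡ (jacobiTerm m k) (⊕-congʳ 𝟙 (λ t → sym (q^-+ (suc n) (suc n) t))) t)
      where
      commute : ∀ (x u g : Series) → x ⊛ (u ⊛ g) ≗ u ⊛ (x ⊛ g)
      commute = solve 3 (λ x u g → (x · (u · g)) ⊜ (u · (x · g))) (λ _ → refl)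
    one-down : ∀ k → q^ sqDist m k ⊛ (q²^ (suc n ∸ k) ⊛ previous (gaussian n) k) ≗ a ⊛ previous (jacobiTerm m) k
    one-down zero t = trans (⊛-vanishʳ _ (⊛-vanishʳ _ (λ _ → refl)) t) (sym (⊛-zeroʳ a t))
    one-down (suc k) = q^-exchange (sqDist m (suc k)) ((n ∸ k) + (n ∸ k)) (suc n) (sqDist m k) n k (sqDist-step-down m k)
    one-up : q^ e ⊛ (q²^ suc k ⊛ gaussian n (suc k)) ≗ a ⊛ jacobiTerm m (suc k)
    one-up = q^-exchange e (suc k + suc k) (suc n) (sqDist m (suc k)) n (suc k) (λ _ → sqDist-step-up m k)

  sign : ℕ → ℤ
  sign zero = + 1
  sign (suc n) = ℤ.- sign n

  sign-² : ∀ n → sign n ℤ.* sign n ≡ + 1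
  sign-² zero = refl
  sign-² (suc n) = trans (neg-² (sign n)) (sign-² n)
    where
    neg-² : ∀ s → (ℤ.- s) ℤ.* (ℤ.- s) ≡ s ℤ.* s
    neg-² = solve-∀

  scale-sign-involutive : ∀ n f → scale (sign n) (scale (sign n) f) ≗ f
  scale-sign-involutive n f t =
    trans (sym (ℤP.*-assoc (sign n) (sign n) (f t))) (trans (cong (ℤ._* f t) (sign-² n)) (ℤP.*-identityˡ (f t)))

  alternatingSum : (ℕ → Series) → ℕ → Series
  alternatingSum f zero = 𝟘
  alternatingSum f (suc n) = alternatingSum f n ⊕ scale (sign n) (f n)

  alternatingSum-cong : ∀ {f g} n → (∀ k → f k ≗ g k) → alternatingSum f n ≗ alternatingSum g n
  alternatingSum-cong zero p t = refl
  alternatingSum-cong (suc n) p t = cong₂ ℤ._+_ (alternatingSum-cong n p t) (cong (sign n ℤ.*_) (p n t))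

  alternatingSum-previous : ∀ f n → alternatingSum (previous f) (suc n) ≗ ⊖ alternatingSum f n
  alternatingSum-previous f zero t = ℤP.*-zeroʳ (+ 1)
  alternatingSum-previous f (suc n) t =
    trans (cong (λ z → z ℤ.+ (sign (suc n) ℤ.* f n t)) (alternatingSum-previous f n t))
          (negate (alternatingSum f n t) (sign n) (f n t))
    where
    negate : ∀ a s x → ℤ.- a ℤ.+ (ℤ.- s) ℤ.* x ≡ ℤ.- (a ℤ.+ s ℤ.* x)
    negate = solve-∀

  alternatingSum-truncate : ∀ f n k → (∀ j → n ≤ j → f j ≗ 𝟘) → alternatingSum f (k + n) ≗ alternatingSum f n
  alternatingSum-truncate f n zero p t = refl
  alternatingSum-truncate f n (suc k) p t =
    trans (cong₂ ℤ._+_ (alternatingSum-truncate f n k p t) (cong (sign (k + n) ℤ.*_) (p (k + n) (ℕP.m≤n+m n k) t)))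
          (trans (cong (ℤ._+_ (alternatingSum f n t)) (ℤP.*-zeroʳ (sign (k + n)))) (ℤP.+-identityʳ _))

  alternatingSum-⊕ : ∀ f g n → alternatingSum (λ k → f k ⊕ g k) n ≗ alternatingSum f n ⊕ alternatingSum g n
  alternatingSum-⊕ f g zero t = refl
  alternatingSum-⊕ f g (suc n) t =
    trans (cong₂ ℤ._+_ (alternatingSum-⊕ f g n t) (ℤP.*-distribˡ-+ (sign n) (f n t) (g n t)))
          (⊕-interchange (alternatingSum f n) (alternatingSum g n) (scale (sign n) (f n)) (scale (sign n) (g n)) t)

  alternatingSum-⊛ : ∀ a f n → alternatingSum (λ k → a ⊛ f k) n ≗ a ⊛ alternatingSum f n
  alternatingSum-⊛ a f zero t = sym (⊛-zeroʳ a t)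
  alternatingSum-⊛ a f (suc n) t =
    trans (cong₂ ℤ._+_ (alternatingSum-⊛ a f n t) (sym (⊛-scaleʳ a (sign n) (f n) t)))
          (sym (⊛-distribˡ a (alternatingSum f n) (scale (sign n) (f n)) t))

  jacobiSum : ℕ → Series
  jacobiSum m = alternatingSum (jacobiTerm m) (suc (m + m))

  oddPoch : ℕ → Series
  oddPoch m = ∏ (λ i → 𝟙 ⊕ ⊖ oddPower i) m

  jacobiTerm-vanish : ∀ m j → suc (m + m) ≤ j → jacobiTerm m j ≗ 𝟘
  jacobiTerm-vanish m j l = ⊛-vanishʳ _ (gaussian-vanish (m + m) j l)

  jacobiSum-recurrence : ∀ m → jacobiSum (suc m) ≗
    (𝟙 ⊕ oddPower m ⊛ oddPower m) ⊛ (⊖ jacobiSum m) ⊕ (oddPower m ⊛ jacobiSum m ⊕ oddPower m ⊛ jacobiSum m)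
  jacobiSum-recurrence m = begin
      alternatingSum (jacobiTerm (suc m)) (suc (suc m + suc m))
        ≡⟨ cong (alternatingSum (jacobiTerm (suc m))) (cong (λ z → suc (suc z)) (ℕP.+-suc m m)) ⟩
      alternatingSum (jacobiTerm (suc m)) L
        ≈⟨ alternatingSum-cong L (jacobiTerm-recurrence m) ⟩
      alternatingSum (λ k → u ⊛ previous c k ⊕ (a ⊛ previous (previous c) k ⊕ a ⊛ c k)) L
        ≈⟨ (λ t → trans (alternatingSum-⊕ _ _ L t) (⊕-congʳ (alternatingSum (λ k → u ⊛ previous c k) L) (alternatingSum-⊕ _ _ L) t)) ⟩
      alternatingSum (λ k → u ⊛ previous c k) L ⊕ (alternatingSum (λ k → a ⊛ previous (previous c) k) L ⊕ alternatingSum (λ k → a ⊛ c k) L)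
        ≈⟨ ⊕-cong (alternatingSum-⊛ u (previous c) L) (⊕-cong (alternatingSum-⊛ a (previous (previous c)) L) (alternatingSum-⊛ a c L)) ⟩
      u ⊛ alternatingSum (previous c) L ⊕ (a ⊛ alternatingSum (previous (previous c)) L ⊕ a ⊛ alternatingSum c L)
        ≈⟨ ⊕-cong (⊛-congʳ u once-shifted) (⊕-cong (⊛-congʳ a twice-shifted) (⊛-congʳ a unshifted)) ⟩
      u ⊛ (⊖ S) ⊕ (a ⊛ S ⊕ a ⊛ S) ∎
    where
    open ≗-Reasoning
    a = oddPower m
    u = 𝟙 ⊕ a ⊛ a
    c = jacobiTerm m
    S = jacobiSum m
    L = suc (suc (suc (m + m)))
    once-shifted : alternatingSum (previous c) L ≗ ⊖ S
    once-shifted t = trans (alternatingSum-previous c (suc (suc (m + m))) t)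
                           (cong ℤ.-_ (alternatingSum-truncate c (suc (m + m)) 1 (jacobiTerm-vanish m) t))
    twice-shifted : alternatingSum (previous (previous c)) L ≗ S
    twice-shifted t = trans (alternatingSum-previous (previous c) (suc (suc (m + m))) t)
                            (trans (cong ℤ.-_ (alternatingSum-previous c (suc (m + m)) t)) (ℤP.neg-involutive (S t)))
    unshifted : alternatingSum c L ≗ S
    unshifted = alternatingSum-truncate c (suc (m + m)) 2 (jacobiTerm-vanish m)

  one-minus-⊛ : ∀ a y → (𝟙 ⊕ ⊖ a) ⊛ y ≗ y ⊕ ⊖ (a ⊛ y)
  one-minus-⊛ a y t = trans (one+-⊛ (⊖ a) y t) (cong (ℤ._+_ (y t)) (⊛-negˡ a y t))

  square-completion : ∀ a S → (𝟙 ⊕ a ⊛ a) ⊛ (⊖ S) ⊕ (a ⊛ S ⊕ a ⊛ S) ≗ ⊖ (((𝟙 ⊕ ⊖ a) ⊛ (𝟙 ⊕ ⊖ a)) ⊛ S)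
  square-completion a S = begin
      (𝟙 ⊕ a ⊛ a) ⊛ (⊖ S) ⊕ (a ⊛ S ⊕ a ⊛ S)
        ≈⟨ ⊕-congˡ (a ⊛ S ⊕ a ⊛ S) (λ t → trans (⊛-negʳ _ S t) (cong ℤ.-_ (one+-⊛ (a ⊛ a) S t))) ⟩
      ⊖ (S ⊕ (a ⊛ a) ⊛ S) ⊕ (a ⊛ S ⊕ a ⊛ S)
        ≈⟨ (λ t → regroup (S t) ((a ⊛ S) t) (((a ⊛ a) ⊛ S) t)) ⟩
      ⊖ ((S ⊕ ⊖ (a ⊛ S)) ⊕ ⊖ (a ⊛ S ⊕ ⊖ ((a ⊛ a) ⊛ S)))
        ≈⟨ (λ t → cong ℤ.-_ (cong₂ (λ x y → x ℤ.+ ℤ.- y) (sym (one-minus-⊛ a S t))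
                   (trans (⊕-congʳ (a ⊛ S) (λ t → cong ℤ.-_ (⊛-assoc a a S t)) t) (sym (one-minus-⊛ a (a ⊛ S) t))))) ⟩
      ⊖ ((𝟙 ⊕ ⊖ a) ⊛ S ⊕ ⊖ ((𝟙 ⊕ ⊖ a) ⊛ (a ⊛ S)))
        ≈⟨ (λ t → cong ℤ.-_ (cong (λ y → ((𝟙 ⊕ ⊖ a) ⊛ S) t ℤ.+ ℤ.- y) (commute (𝟙 ⊕ ⊖ a) a S t))) ⟩
      ⊖ ((𝟙 ⊕ ⊖ a) ⊛ S ⊕ ⊖ (a ⊛ ((𝟙 ⊕ ⊖ a) ⊛ S)))
        ≈⟨ (λ t → cong ℤ.-_ (sym (one-minus-⊛ a ((𝟙 ⊕ ⊖ a) ⊛ S) t))) ⟩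
      ⊖ ((𝟙 ⊕ ⊖ a) ⊛ ((𝟙 ⊕ ⊖ a) ⊛ S))
        ≈⟨ (λ t → cong ℤ.-_ (sym (⊛-assoc (𝟙 ⊕ ⊖ a) (𝟙 ⊕ ⊖ a) S t))) ⟩
      ⊖ (((𝟙 ⊕ ⊖ a) ⊛ (𝟙 ⊕ ⊖ a)) ⊛ S) ∎
    where
    open ≗-Reasoning
    regroup : ∀ s x y → ℤ.- (s ℤ.+ y) ℤ.+ (x ℤ.+ x) ≡ ℤ.- ((s ℤ.+ ℤ.- x) ℤ.+ ℤ.- (x ℤ.+ ℤ.- y))
    regroup = solve-∀
    commute : ∀ (x a y : Series) → x ⊛ (a ⊛ y) ≗ a ⊛ (x ⊛ y)
    commute = solve 3 (λ x a y → (x · (a · y)) ⊜ (a · (x · y))) (λ _ → refl)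

  finite-triple-product : ∀ m → jacobiSum m ≗ scale (sign m) (oddPoch m ⊛ oddPoch m)
  finite-triple-product zero t =
    trans (ℤP.+-identityˡ _) (cong (ℤ._*_ (+ 1)) (trans (⊛-identityˡ _ t) (sym (⊛-identityˡ 𝟙 t))))
  finite-triple-product (suc m) = begin
      jacobiSum (suc m)                                   ≈⟨ jacobiSum-recurrence m ⟩
      (𝟙 ⊕ a ⊛ a) ⊛ (⊖ S) ⊕ (a ⊛ S ⊕ a ⊛ S)              ≈⟨ square-completion a S ⟩
      ⊖ ((u ⊛ u) ⊛ S)                                     ≈⟨ (λ t → cong ℤ.-_ (⊛-congʳ (u ⊛ u) (finite-triple-product m) t)) ⟩
      ⊖ ((u ⊛ u) ⊛ scale (sign m) (O ⊛ O))
        ≈⟨ (λ t → trans (cong ℤ.-_ (⊛-scaleʳ (u ⊛ u) (sign m) (O ⊛ O) t)) (ℤP.neg-distribˡ-* (sign m) _)) ⟩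
      scale (sign (suc m)) ((u ⊛ u) ⊛ (O ⊛ O))            ≈⟨ (λ t → cong (ℤ._*_ (sign (suc m))) (regroup O u t)) ⟩
      scale (sign (suc m)) ((O ⊛ u) ⊛ (O ⊛ u))            ∎
    where
    open ≗-Reasoning
    a = oddPower m
    S = jacobiSum m
    u = 𝟙 ⊕ ⊖ a
    O = oddPoch m
    regroup : ∀ (o u : Series) → (u ⊛ u) ⊛ (o ⊛ o) ≗ (o ⊛ u) ⊛ (o ⊛ u)
    regroup = solve 2 (λ o u → ((u · u) · (o · o)) ⊜ ((o · u) · (o · u))) (λ _ → refl)

-- Gauss's identity  ∏_{s ≥ 1} (1 - qˢ)/(1 + qˢ) = Σ_{n ∈ ℤ} (-1)ⁿ q^{n²},
-- up to degree M, by letting m → ∞ in the finite triple product: after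
-- multiplying by (q²; q²)ₘ, the term q^{(k-m)²} [2m, k] tends to
-- q^{(k-m)²}, while (q; q²)ₘ (q²; q²)ₘ = (q; q)_{2m} and
-- (q; q²)ₘ² (q²; q²)ₘ → (q; q) / (-q; q) by Euler's identity
-- (q; q²)_∞ (-q; q)_∞ = 1.  Everything holds modulo any d, so in
-- particular as an exact identity of truncations.
module GaussIdentity where

  open import Data.Nat using (zero; suc; s≤s; _≤_; _∸_)
  import Data.Nat.Properties as ℕP
  import Data.Nat.Tactic.RingSolver as ℕSolver
  import Data.Integer as ℤ
  open ℤ using (ℤ; +_)
  import Data.Integer.Properties as ℤP
  open import Data.Integer.Tactic.RingSolver using (solve-∀)
  open import Relation.Binary.PropositionalEquality
  open import Data.Sum using (inj₁; inj₂)
  open PowerSeries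
  open ⊛-Solver using (solve; _⊜_; _·_)
  open Monomials
  open Products
  open Factors
  open GaussianBinomials
  open TripleProduct

  -- Σ_{k=0}^{2m} (-1)ᵏ q^{(k-m)²} = (-1)ᵐ Σ_{|n| ≤ m} (-1)ⁿ q^{n²}
  theta : ℕ → Series
  theta m = alternatingSum (λ k → q^ sqDist m k) (suc (m + m))

  q²Poch⁻¹ : ℕ → Series
  q²Poch⁻¹ n = ∏ (λ i → geometric (suc i + suc i)) n

  q²Poch-inverse : ∀ n → q²Poch n ⊛ q²Poch⁻¹ n ≗ 𝟙
  q²Poch-inverse n = ∏-inverse _ _ n (λ i → geometric-inverse (i + suc i))

  qPoch negqPoch negqPoch⁻¹ : ℕ → Series
  qPoch n = ∏ (λ i → 𝟙 ⊕ ⊖ q^ suc i) n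
  negqPoch n = ∏ (λ i → 𝟙 ⊕ q^ suc i) n
  negqPoch⁻¹ n = ∏ (λ i → invOnePlus (suc i)) n

  negqPoch-inverse : ∀ n → negqPoch n ⊛ negqPoch⁻¹ n ≗ 𝟙
  negqPoch-inverse n = ∏-inverse _ _ n invOnePlus-inverse

  negqPoch-qPoch : ∀ n → negqPoch n ⊛ qPoch n ≗ q²Poch n
  negqPoch-qPoch n t = trans (∏-⊛ _ _ n t) (∏-cong n (λ i _ → difference-of-squares (suc i)) t)

  qPoch-split : ∀ m → qPoch (m + m) ≗ oddPoch m ⊛ q²Poch m
  qPoch-split zero t = sym (⊛-identityˡ 𝟙 t)
  qPoch-split (suc m) =
    begin
      qPoch (suc m + suc m)                           ≡⟨ cong qPoch (cong suc (ℕP.+-suc m m)) ⟩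
      (qPoch (m + m) ⊛ (𝟙 ⊕ ⊖ odd)) ⊛ (𝟙 ⊕ ⊖ even)   ≈⟨ ⊛-congˡ (𝟙 ⊕ ⊖ even) (⊛-congˡ (𝟙 ⊕ ⊖ odd) (qPoch-split m)) ⟩
      ((O ⊛ Q) ⊛ (𝟙 ⊕ ⊖ odd)) ⊛ (𝟙 ⊕ ⊖ even)         ≈⟨ regroup O Q (𝟙 ⊕ ⊖ odd) (𝟙 ⊕ ⊖ even) ⟩
      (O ⊛ (𝟙 ⊕ ⊖ odd)) ⊛ (Q ⊛ (𝟙 ⊕ ⊖ even))
        ≈⟨ ⊛-congʳ (O ⊛ (𝟙 ⊕ ⊖ odd)) (⊛-congʳ Q (⊕-congʳ 𝟙 (λ t → cong ℤ.-_ (q^-cong (cong suc (sym (ℕP.+-suc m m))) t)))) ⟩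
      oddPoch (suc m) ⊛ q²Poch (suc m)               ∎
    where
    open ≗-Reasoning
    O = oddPoch m
    Q = q²Poch m
    odd = q^ suc (m + m)
    even = q^ suc (suc (m + m))
    regroup : ∀ (o q a b : Series) → ((o ⊛ q) ⊛ a) ⊛ b ≗ (o ⊛ a) ⊛ (q ⊛ b)
    regroup = solve 4 (λ o q a b → (((o · q) · a) · b) ⊜ ((o · a) · (q · b))) (λ _ → refl)

  P⁻¹-product : ∀ M → ∏ (λ j → P⁻¹ (suc j)) M ≗ qPoch M ⊛ negqPoch⁻¹ M
  P⁻¹-product M t = sym (∏-⊛ _ _ M t)

  sqDist-above : ∀ M δ → sqDist M (M + δ) ≡ δ * δ
  sqDist-above M δ = ℤP.+-injective (trans (sq-ℤ ((+ M ℤ.+ + δ) ℤ.- + M)) (trans (cancel (+ M) (+ δ)) (sym (ℤP.pos-* δ δ))))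
    where
    cancel : ∀ m δ → ((m ℤ.+ δ) ℤ.- m) ℤ.* ((m ℤ.+ δ) ℤ.- m) ≡ δ ℤ.* δ
    cancel = solve-∀

  sqDist-below : ∀ δ K → sqDist (δ + K) K ≡ δ * δ
  sqDist-below δ K = ℤP.+-injective (trans (sq-ℤ (+ K ℤ.- (+ δ ℤ.+ + K))) (trans (cancel (+ K) (+ δ)) (sym (ℤP.pos-* δ δ))))
    where
    cancel : ∀ k δ → (k ℤ.- (δ ℤ.+ k)) ℤ.* (k ℤ.- (δ ℤ.+ k)) ≡ δ ℤ.* δ
    cancel = solve-∀

  record Centred (M k : ℕ) : Set where
    field
      δ K : ℕ
      M≡δ+K : M ≡ δ + K
      distance : sqDist M k ≡ δ * δ
      K≤k : K ≤ k
      K≤2M-k : K ≤ (M + M) ∸ k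

  centred : ∀ M k → k ≤ M + M → Centred M k
  centred M k k≤2M with ℕP.≤-total k M
  ... | inj₁ k≤M = record
    { δ = M ∸ k ; K = k ; M≡δ+K = sym M-k+k ; K≤k = ℕP.≤-refl
    ; distance = subst (λ z → sqDist z k ≡ (M ∸ k) * (M ∸ k)) M-k+k (sqDist-below (M ∸ k) k)
    ; K≤2M-k = subst (k ≤_) (sym (ℕP.+-∸-assoc M k≤M)) (ℕP.≤-trans k≤M (ℕP.m≤m+n M (M ∸ k))) }
    where
    M-k+k : (M ∸ k) + k ≡ M
    M-k+k = ℕP.m∸n+n≡m k≤M
  ... | inj₂ M≤k = record
    { δ = δ ; K = M ∸ δ ; M≡δ+K = sym (ℕP.m+[n∸m]≡n δ≤M) ; K≤k = ℕP.≤-trans (ℕP.m∸n≤m M δ) M≤k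
    ; distance = subst (λ z → sqDist M z ≡ δ * δ) M+δ≡k (sqDist-above M δ)
    ; K≤2M-k = ℕP.≤-reflexive (trans (sym (ℕP.[m+n]∸[m+o]≡n∸o M M δ)) (cong (M + M ∸_) M+δ≡k)) }
    where
    δ = k ∸ M
    M+δ≡k : M + δ ≡ k
    M+δ≡k = ℕP.m+[n∸m]≡n M≤k
    δ≤M : δ ≤ M
    δ≤M = ℕP.+-cancelˡ-≤ M δ M (subst (_≤ M + M) (sym M+δ≡k) k≤2M)

  below-precision : ∀ δ K → suc (δ + K) ≤ δ * δ + (suc K + suc K)
  below-precision zero K = ℕP.m≤m+n (suc K) (suc K)
  below-precision (suc δ) K =
    subst (suc (suc δ + K) ≤_) (expand δ K) (ℕP.m≤m+n (suc (suc δ + K)) (δ * suc δ + suc K))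
    where
    expand : ∀ δ K → suc (suc δ + K) + (δ * suc δ + suc K) ≡ suc δ * suc δ + (suc K + suc K)
    expand = ℕSolver.solve-∀

  module _ {d : ℤ} where
    open TruncatedCongruence d

    q²Poch-truncate : ∀ a b → a ≤ b → q²Poch b ≡[ suc a + suc a ] q²Poch a
    q²Poch-truncate a b a≤b =
      ∏-extend _ a b a≤b (λ i a≤i → one-minus-≡[] (suc i + suc i) (ℕP.+-mono-≤ (s≤s a≤i) (s≤s a≤i)))

    qPoch-truncate : ∀ a b → a ≤ b → qPoch b ≡[ suc a ] qPoch a
    qPoch-truncate a b a≤b = ∏-extend _ a b a≤b (λ i a≤i → one-minus-≡[] (suc i) (s≤s a≤i))

    negqPoch⁻¹-truncate : ∀ a b → a ≤ b → negqPoch⁻¹ b ≡[ suc a ] negqPoch⁻¹ a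
    negqPoch⁻¹-truncate a b a≤b = ∏-extend _ a b a≤b (λ i a≤i → ≡[]-weaken (s≤s a≤i) (invOnePlus-≡[]-𝟙 i))

    ≡[]-alternatingSum : ∀ {E f g} n → (∀ k → k < n → f k ≡[ E ] g k) → alternatingSum f n ≡[ E ] alternatingSum g n
    ≡[]-alternatingSum zero p = ≡[]-refl 𝟘
    ≡[]-alternatingSum (suc n) p =
      ≡[]-⊕ (≡[]-alternatingSum n (λ k l → p k (ℕP.m<n⇒m<1+n l))) (≡[]-scale (sign n) (p n ℕP.≤-refl))

    -- [n, k] → 1/(q²; q²)_∞ as k, n - k → ∞: below degree 2(K + 1),
    -- [n, k] (q²; q²)ₘ ≡ 1 as soon as k, n - k, m ≥ K
    gaussian-limit : ∀ n k m K → k ≤ n → K ≤ k → K ≤ n ∸ k → K ≤ m → gaussian n k ⊛ q²Poch m ≡[ suc K + suc K ] 𝟙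
    gaussian-limit n k m K k≤n K≤k K≤n-k K≤m = begin
        g ⊛ q²Poch m                               ≈⟨ ≡[]-⊛ʳ g (q²Poch-truncate K m K≤m) ⟩
        g ⊛ q²Poch K                               ≗⟨ ⊛-identityʳ _ ⟨
        (g ⊛ q²Poch K) ⊛ 𝟙                         ≗⟨ ⊛-congʳ (g ⊛ q²Poch K) (q²Poch-inverse K) ⟨
        (g ⊛ q²Poch K) ⊛ (q²Poch K ⊛ q²Poch⁻¹ K)   ≗⟨ regroup g (q²Poch K) (q²Poch⁻¹ K) ⟩
        ((g ⊛ q²Poch K) ⊛ q²Poch K) ⊛ q²Poch⁻¹ K   ≈⟨ ≡[]-⊛ˡ (q²Poch⁻¹ K) (≡[]-⊛ (≡[]-⊛ʳ g (≡[]-sym (q²Poch-truncate K k K≤k)))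
                                                                               (≡[]-sym (q²Poch-truncate K (n ∸ k) K≤n-k))) ⟩
        ((g ⊛ q²Poch k) ⊛ q²Poch (n ∸ k)) ⊛ q²Poch⁻¹ K
                                                   ≗⟨ ⊛-congˡ (q²Poch⁻¹ K) (gaussian-product n k k≤n) ⟩
        q²Poch n ⊛ q²Poch⁻¹ K                      ≈⟨ ≡[]-⊛ˡ (q²Poch⁻¹ K) (q²Poch-truncate K n (ℕP.≤-trans K≤k k≤n)) ⟩
        q²Poch K ⊛ q²Poch⁻¹ K                      ≗⟨ q²Poch-inverse K ⟩
        𝟙                                          ∎
      where
      open ≡[]-Reasoning (suc K + suc K)
      g = gaussian n k
      regroup : ∀ (g q h : Series) → (g ⊛ q) ⊛ (q ⊛ h) ≗ ((g ⊛ q) ⊛ q) ⊛ h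
      regroup = solve 3 (λ g q h → ((g · q) · (q · h)) ⊜ (((g · q) · q) · h)) (λ _ → refl)

    jacobiTerm-limit : ∀ M k → k ≤ M + M → jacobiTerm M k ⊛ q²Poch M ≡[ suc M ] q^ sqDist M k
    jacobiTerm-limit M k k≤2M = ≡[]-weaken enough (begin
        (q^ sqDist M k ⊛ g) ⊛ q²Poch M   ≗⟨ ⊛-assoc (q^ sqDist M k) g (q²Poch M) ⟩
        q^ sqDist M k ⊛ (g ⊛ q²Poch M)   ≈⟨ q^-≡[] (sqDist M k) (gaussian-limit (M + M) k M K k≤2M K≤k K≤2M-k K≤M) ⟩
        q^ sqDist M k ⊛ 𝟙                ≗⟨ ⊛-identityʳ (q^ sqDist M k) ⟩
        q^ sqDist M k                    ∎)
      where
      open Centred (centred M k k≤2M)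
      open ≡[]-Reasoning (sqDist M k + (suc K + suc K))
      g = gaussian (M + M) k
      K≤M : K ≤ M
      K≤M = subst (K ≤_) (sym M≡δ+K) (ℕP.m≤n+m K δ)
      enough : suc M ≤ sqDist M k + (suc K + suc K)
      enough = subst₂ (λ a b → suc a ≤ b + (suc K + suc K)) (sym M≡δ+K) (sym distance) (below-precision δ K)

    jacobiSum-limit : ∀ M → jacobiSum M ⊛ q²Poch M ≡[ suc M ] theta M
    jacobiSum-limit M = begin
        jacobiSum M ⊛ q²Poch M                                   ≗⟨ ⊛-comm (jacobiSum M) (q²Poch M) ⟩
        q²Poch M ⊛ jacobiSum M                                   ≗⟨ alternatingSum-⊛ (q²Poch M) (jacobiTerm M) (suc (M + M)) ⟨
        alternatingSum (λ k → q²Poch M ⊛ jacobiTerm M k) (suc (M + M))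
          ≈⟨ ≡[]-alternatingSum (suc (M + M)) (λ k k≤2M → ≡[]-trans (≗⇒≡[] (⊛-comm (q²Poch M) (jacobiTerm M k)))
                                                                   (jacobiTerm-limit M k (ℕP.≤-pred k≤2M))) ⟩
        theta M                                                  ∎
      where open ≡[]-Reasoning (suc M)

    oddPoch-negqPoch : ∀ m → oddPoch m ⊛ negqPoch (m + m) ≡[ suc m + suc m ] 𝟙
    oddPoch-negqPoch m = begin
        O ⊛ negqPoch (m + m)                               ≗⟨ ⊛-identityʳ _ ⟨
        (O ⊛ negqPoch (m + m)) ⊛ 𝟙                         ≗⟨ ⊛-congʳ (O ⊛ negqPoch (m + m)) (q²Poch-inverse m) ⟨
        (O ⊛ negqPoch (m + m)) ⊛ (q²Poch m ⊛ q²Poch⁻¹ m)   ≗⟨ regroup O (negqPoch (m + m)) (q²Poch m) (q²Poch⁻¹ m) ⟩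
        ((O ⊛ q²Poch m) ⊛ negqPoch (m + m)) ⊛ q²Poch⁻¹ m   ≗⟨ ⊛-congˡ (q²Poch⁻¹ m) (⊛-congˡ (negqPoch (m + m)) (qPoch-split m)) ⟨
        (qPoch (m + m) ⊛ negqPoch (m + m)) ⊛ q²Poch⁻¹ m    ≗⟨ ⊛-congˡ (q²Poch⁻¹ m) (λ t → trans (⊛-comm _ _ t) (negqPoch-qPoch (m + m) t)) ⟩
        q²Poch (m + m) ⊛ q²Poch⁻¹ m                        ≈⟨ ≡[]-⊛ˡ (q²Poch⁻¹ m) (q²Poch-truncate m (m + m) (ℕP.m≤m+n m m)) ⟩
        q²Poch m ⊛ q²Poch⁻¹ m                              ≗⟨ q²Poch-inverse m ⟩
        𝟙                                                  ∎
      where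
      open ≡[]-Reasoning (suc m + suc m)
      O = oddPoch m
      regroup : ∀ (o p q g : Series) → (o ⊛ p) ⊛ (q ⊛ g) ≗ ((o ⊛ q) ⊛ p) ⊛ g
      regroup = solve 4 (λ o p q g → ((o · p) · (q · g)) ⊜ (((o · q) · p) · g)) (λ _ → refl)

    oddPoch-≡[]-negqPoch⁻¹ : ∀ m → oddPoch m ≡[ suc m + suc m ] negqPoch⁻¹ (m + m)
    oddPoch-≡[]-negqPoch⁻¹ m = begin
        oddPoch m                                             ≗⟨ ⊛-identityʳ _ ⟨
        oddPoch m ⊛ 𝟙                                         ≗⟨ ⊛-congʳ (oddPoch m) (negqPoch-inverse (m + m)) ⟨
        oddPoch m ⊛ (negqPoch (m + m) ⊛ negqPoch⁻¹ (m + m))   ≗⟨ ⊛-assoc _ _ _ ⟨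
        (oddPoch m ⊛ negqPoch (m + m)) ⊛ negqPoch⁻¹ (m + m)   ≈⟨ ≡[]-⊛ˡ (negqPoch⁻¹ (m + m)) (oddPoch-negqPoch m) ⟩
        𝟙 ⊛ negqPoch⁻¹ (m + m)                                ≗⟨ ⊛-identityˡ _ ⟩
        negqPoch⁻¹ (m + m)                                    ∎
      where open ≡[]-Reasoning (suc m + suc m)

    gauss-identity : ∀ M → ∏ (λ j → P⁻¹ (suc j)) M ≡[ suc M ] scale (sign M) (theta M)
    gauss-identity M = begin
        ∏ (λ j → P⁻¹ (suc j)) M                         ≗⟨ P⁻¹-product M ⟩
        qPoch M ⊛ negqPoch⁻¹ M                           ≈⟨ ≡[]-⊛ (≡[]-sym (qPoch-truncate M (M + M) M≤2M))
                                                                 (≡[]-sym (negqPoch⁻¹-truncate M (M + M) M≤2M)) ⟩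
        qPoch (M + M) ⊛ negqPoch⁻¹ (M + M)               ≈⟨ ≡[]-⊛ʳ (qPoch (M + M)) (≡[]-weaken (ℕP.m≤m+n (suc M) (suc M))
                                                                                       (≡[]-sym (oddPoch-≡[]-negqPoch⁻¹ M))) ⟩
        qPoch (M + M) ⊛ O                                ≗⟨ ⊛-congˡ O (qPoch-split M) ⟩
        (O ⊛ q²Poch M) ⊛ O                               ≗⟨ regroup O (q²Poch M) ⟩
        (O ⊛ O) ⊛ q²Poch M                               ≗⟨ ⊛-congˡ (q²Poch M) (λ t → sym (scale-sign-involutive M (O ⊛ O) t)) ⟩
        scale (sign M) (scale (sign M) (O ⊛ O)) ⊛ q²Poch M
                                                         ≗⟨ ⊛-congˡ (q²Poch M) (λ t → cong (ℤ._*_ (sign M)) (finite-triple-product M t)) ⟨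
        scale (sign M) (jacobiSum M) ⊛ q²Poch M          ≗⟨ scale-⊛ (sign M) (jacobiSum M) (q²Poch M) ⟩
        scale (sign M) (jacobiSum M ⊛ q²Poch M)          ≈⟨ ≡[]-scale (sign M) (jacobiSum-limit M) ⟩
        scale (sign M) (theta M)                         ∎
      where
      open ≡[]-Reasoning (suc M)
      O = oddPoch M
      M≤2M = ℕP.m≤m+n M M
      regroup : ∀ (o q : Series) → (o ⊛ q) ⊛ o ≗ (o ⊛ o) ⊛ q
      regroup = solve 2 (λ o q → ((o · q) · o) ⊜ ((o · o) · q)) (λ _ → refl)

module SumsOfSquares where

  open import Data.Nat using (zero; suc)
  import Data.Integer as ℤ
  open ℤ using (ℤ; +_; ∣_∣)
  import Data.Integer.Properties as ℤP
  open import Relation.Binary.PropositionalEquality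
  open import Relation.Nullary using (yes; no)
  open import Data.Product using (_,_)
  open import Data.Sum using (_⊎_; inj₁; inj₂)
  open import Data.Empty using (⊥-elim)
  open PowerSeries
  open Monomials
  open TripleProduct using (sq; alternatingSum; sign)
  open GaussIdentity using (theta)

  SupportedOnSquares : Series → Set
  SupportedOnSquares f = ∀ i → ¬ (f i ≡ + 0) → ∃[ a ] a * a ≡ i

  q^-support : ∀ a i → ¬ ((q^ a) i ≡ + 0) → a ≡ i
  q^-support zero zero _ = refl
  q^-support zero (suc i) p = ⊥-elim (p refl)
  q^-support (suc a) zero p = ⊥-elim (p refl)
  q^-support (suc a) (suc i) p = cong suc (q^-support a i p)

  q^sq-supported : ∀ z → SupportedOnSquares (q^ sq z)
  q^sq-supported z i p = ∣ z ∣ , trans (sym (ℤP.abs-* z z)) (q^-support (sq z) i p)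

  ⊕-supported : ∀ f g → SupportedOnSquares f → SupportedOnSquares g → SupportedOnSquares (f ⊕ g)
  ⊕-supported f g sf sg i p with f i ℤ.≟ + 0
  ... | no fᵢ≢0 = sf i fᵢ≢0
  ... | yes fᵢ≡0 = sg i (λ gᵢ≡0 → p (cong₂ ℤ._+_ fᵢ≡0 gᵢ≡0))

  scale-supported : ∀ c f → SupportedOnSquares f → SupportedOnSquares (scale c f)
  scale-supported c f sf i p = sf i (λ fᵢ≡0 → p (trans (cong (c ℤ.*_) fᵢ≡0) (ℤP.*-zeroʳ c)))

  alternatingSum-supported : ∀ f n → (∀ k → SupportedOnSquares (f k)) → SupportedOnSquares (alternatingSum f n)
  alternatingSum-supported f zero h i p = ⊥-elim (p refl)
  alternatingSum-supported f (suc n) h =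
    ⊕-supported _ _ (alternatingSum-supported f n h) (scale-supported (sign n) (f n) (h n))

  theta-supported : ∀ M → SupportedOnSquares (theta M)
  theta-supported M = alternatingSum-supported _ (suc (M + M)) (λ k → q^sq-supported (+ k ℤ.- + M))

  ⊛-vanishes-at : ∀ N (f g : Series) → (∀ i j → i + j ≡ N → f i ≡ + 0 ⊎ g j ≡ + 0) → (f ⊛ g) N ≡ + 0
  ⊛-vanishes-at zero f g h with h 0 0 refl
  ... | inj₁ p = cong (ℤ._* g 0) p
  ... | inj₂ p = trans (cong (f 0 ℤ.*_) p) (ℤP.*-zeroʳ (f 0))
  ⊛-vanishes-at (suc N) f g h =
    cong₂ ℤ._+_ first (⊛-vanishes-at N (tail f) g (λ i j e → h (suc i) j (cong suc e)))
    where
    first : f 0 ℤ.* g (suc N) ≡ + 0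
    first with h 0 (suc N) refl
    ... | inj₁ p = cong (ℤ._* g (suc N)) p
    ... | inj₂ p = trans (cong (f 0 ℤ.*_) p) (ℤP.*-zeroʳ (f 0))

  supported-⊛-vanishes : ∀ f g → SupportedOnSquares f → SupportedOnSquares g →
    ∀ N → ¬ (∃[ a ] ∃[ b ] a * a + b * b ≡ N) → (f ⊛ g) N ≡ + 0
  supported-⊛-vanishes f g sf sg N not-sum = ⊛-vanishes-at N f g one-vanishes
    where
    one-vanishes : ∀ i j → i + j ≡ N → f i ≡ + 0 ⊎ g j ≡ + 0
    one-vanishes i j i+j≡N with f i ℤ.≟ + 0 | g j ℤ.≟ + 0
    ... | yes fᵢ≡0 | _ = inj₁ fᵢ≡0
    ... | no _ | yes gⱼ≡0 = inj₂ gⱼ≡0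
    ... | no fᵢ≢0 | no gⱼ≢0 with sf i fᵢ≢0 | sg j gⱼ≢0
    ... | a , a²≡i | b , b²≡j = ⊥-elim (not-sum (a , b , trans (cong₂ _+_ a²≡i b²≡j) i+j≡N))

  theta²-vanishes : ∀ M N → ¬ (∃[ a ] ∃[ b ] a * a + b * b ≡ N) → (theta M ⊛ theta M) N ≡ + 0
  theta²-vanishes M = supported-⊛-vanishes (theta M) (theta M) (theta-supported M) (theta-supported M)

module MainCongruence where

  open import Data.Nat using (suc)
  import Data.Nat.Properties as ℕP
  import Data.Integer as ℤ
  open ℤ using (+_)
  import Data.Integer.Properties as ℤP
  import Data.Integer.Divisibility.Signed as ℤ∣
  open import Relation.Binary.PropositionalEquality
  open PowerSeries
  open TruncatedCongruence (+ 3)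
  open Counting using (GF; Cbar-GF)
  open ReductionToSquare using (GF-≡[]-B²)
  open TripleProduct using (sign; scale-sign-involutive)
  open GaussIdentity using (theta; gauss-identity)

  GF-≡[]-theta² : ∀ N → GF N ≡[ suc N ] theta N ⊛ theta N
  GF-≡[]-theta² N = begin
      GF N                            ≈⟨ GF-≡[]-B² N ⟩
      ∏B ⊛ ∏B                         ≈⟨ ≡[]-⊛ (gauss-identity N) (gauss-identity N) ⟩
      scale s θ ⊛ scale s θ           ≗⟨ sign-squared ⟩
      θ ⊛ θ                           ∎
    where
    open ≡[]-Reasoning (suc N)
    ∏B = ReductionToSquare.B N
    θ = theta N
    s = sign N
    sign-squared : scale s θ ⊛ scale s θ ≗ θ ⊛ θ
    sign-squared t = trans (scale-⊛ s θ (scale s θ) t)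
      (trans (cong (s ℤ.*_) (⊛-scaleʳ θ s θ t)) (scale-sign-involutive N (θ ⊛ θ) t))

  Cbar-≡-theta² : ∀ N → + 3 ℤ∣.∣ + Cbar 3 1 N ℤ.- (theta N ⊛ theta N) N
  Cbar-≡-theta² N =
    subst (λ c → + 3 ℤ∣.∣ c ℤ.- (theta N ⊛ theta N) N) (sym (Cbar-GF N))
          (coefficients (GF-≡[]-theta² N) N ℕP.≤-refl)

  divides-ℕ : ∀ c x → + 3 ℤ∣.∣ + c ℤ.- x → x ≡ + 0 → 3 ∣ c
  divides-ℕ c .(+ 0) 3∣c-0 refl = ℤ∣.∣⇒∣ᵤ (subst (+ 3 ℤ∣.∣_) (ℤP.+-identityʳ (+ c)) 3∣c-0)

-- C̄_{3,1}(N) ≡ (θ²)_N (mod 3), and (θ²)_N = 0 since N is not a sum of two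
-- squares
mainTheorem1 : (N : ℕ) → 0 < N → ¬ (∃[ a ] ∃[ b ] a * a + b * b ≡ N) →
    3 ∣ Cbar 3 1 N
mainTheorem1 N _ not-sum = divides-ℕ (Cbar 3 1 N) _ (Cbar-≡-theta² N) (theta²-vanishes N N not-sum)
  where
  open MainCongruence using (divides-ℕ; Cbar-≡-theta²)
  open SumsOfSquares using (theta²-vanishes)
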